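{- Let $n\in\mathbb{N}$. There is a one-to-one correspondence between the set $SC_6(n)$ of self-conjugate $6$-core partitions of $n$ and the set \[ \mathscr{S}_6 = \{ (x,y,z) \in \mathbb{Z}^3 \colon x^2+y^2+z^2 = 24n+35,\ (x,y,z) \equiv (\pm 1, \pm 3, \pm 5) \pmod{12} \}, \] where triples differing only by sign changes of their coordinates are identified.
   Context: A partition is a $6$-core if no hook length $h(j,k)=\lambda_j+\lambda'_k-j-k+1$ of a cell of its Ferrers–Young diagram is divisible by $6$, and self-conjugate if it equals its conjugate (rows and columns interchanged). -}

module Defs where

open import Data.Nat as ℕ using (ℕ; zero; suc; _≤_; _<_; _∸_; _≤?_)
open import Data.Nat.Divisibility as ℕD using ()
open import Data.Integer as ℤ using (ℤ; +_; -_)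
open import Data.Integer.Divisibility as ℤD using ()
open import Data.Integer.Properties as ℤP using (neg-involutive)
open import Data.List using (List; []; _∷_; length; filter; map)
open import Data.Nat.ListAction using (sum)
open import Data.List.Relation.Unary.All using (All)
open import Data.List.Relation.Unary.Linked using (Linked)
open import Data.Product using (Σ; _×_; _,_; proj₁)
open import Data.Sum using (_⊎_; inj₁; inj₂)
open import Relation.Nullary using (¬_)
open import Relation.Binary using (Setoid; IsEquivalence)
open import Relation.Binary.PropositionalEquality as ≡ using (_≡_; refl; sym; trans; cong)
import Relation.Binary.Construct.On as On

IsPartition : ℕ → List ℕ → Set
IsPartition n l = Linked ℕ._≥_ l × All (λ k → 0 < k) l × sum l ≡ n

-- λ_j, 1-indexed (λ_0 unused), 0 beyond the length.
part : List ℕ → ℕ → ℕ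
part []       _             = 0
part (x ∷ xs) zero          = 0
part (x ∷ xs) (suc zero)    = x
part (x ∷ xs) (suc (suc j)) = part xs (suc j)

-- λ'_k = #{ j : λ_j ≥ k }, 1-indexed.
conjPart : List ℕ → ℕ → ℕ
conjPart l k = length (filter (k ≤?_) l)

oneTo : ℕ → List ℕ
oneTo zero    = []
oneTo (suc m) = oneTo m Data.List.++ (suc m ∷ [])
  where import Data.List

largest : List ℕ → ℕ
largest []      = 0
largest (x ∷ _) = x

conjugate : List ℕ → List ℕ
conjugate l = map (conjPart l) (oneTo (largest l))

SelfConjugate : List ℕ → Set
SelfConjugate l = conjugate l ≡ l

-- hook length h(j,k) = λ_j + λ'_k - j - k + 1 (for cells this is ≥ 1)
hook : List ℕ → ℕ → ℕ → ℕ
hook l j k = ((part l j ℕ.+ conjPart l k) ∸ j ∸ k) ℕ.+ 1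

IsCell : List ℕ → ℕ → ℕ → Set
IsCell l j k = 1 ≤ j × j ≤ length l × 1 ≤ k × k ≤ part l j

IsCore : ℕ → List ℕ → Set
IsCore t l = ∀ j k → IsCell l j k → ¬ (t ℕD.∣ hook l j k)

SC6 : ℕ → List ℕ → Set
SC6 n l = IsPartition n l × SelfConjugate l × IsCore 6 l

SC6Setoid : ℕ → Setoid _ _
SC6Setoid n = On.setoid {B = Σ (List ℕ) (SC6 n)} (≡.setoid (List ℕ)) proj₁

_≡_[mod_] : ℤ → ℤ → ℕ → Set
x ≡ a [mod m ] = (+ m) ℤD.∣ (x ℤ.- a)

≡±[mod] : ℤ → ℕ → ℕ → Set
≡±[mod] x a m = (x ≡ + a [mod m ]) ⊎ (x ≡ - (+ a) [mod m ])

Triple : Set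
Triple = ℤ × ℤ × ℤ

InS6 : ℕ → Triple → Set
InS6 n (x , y , z) =
  x ℤ.* x ℤ.+ y ℤ.* y ℤ.+ z ℤ.* z ≡ + (24 ℕ.* n ℕ.+ 35)
  × ≡±[mod] x 1 12 × ≡±[mod] y 3 12 × ≡±[mod] z 5 12

SignEq : ℤ → ℤ → Set
SignEq a b = a ≡ b ⊎ a ≡ - b

_≈±_ : Triple → Triple → Set
(x , y , z) ≈± (x' , y' , z') = SignEq x x' × SignEq y y' × SignEq z z'

private
  se-refl : ∀ {a} → SignEq a a
  se-refl = inj₁ refl

  se-sym : ∀ {a b} → SignEq a b → SignEq b a
  se-sym (inj₁ p) = inj₁ (sym p)
  se-sym {a} {b} (inj₂ p) = inj₂ (trans (sym (neg-involutive b)) (cong -_ (sym p)))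

  se-trans : ∀ {a b c} → SignEq a b → SignEq b c → SignEq a c
  se-trans (inj₁ p) (inj₁ q) = inj₁ (trans p q)
  se-trans (inj₁ p) (inj₂ q) = inj₂ (trans p q)
  se-trans (inj₂ p) (inj₁ q) = inj₂ (trans p (cong -_ q))
  se-trans {c = c} (inj₂ p) (inj₂ q) = inj₁ (trans p (trans (cong -_ q) (neg-involutive c)))

≈±-isEquivalence : IsEquivalence _≈±_
≈±-isEquivalence = record
  { refl  = se-refl , se-refl , se-refl
  ; sym   = λ { (a , b , c) → se-sym a , se-sym b , se-sym c }
  ; trans = λ { (a , b , c) (a' , b' , c') → se-trans a a' , se-trans b b' , se-trans c c' }
  }

TripleSetoid : Setoid _ _
TripleSetoid = record { Carrier = Triple ; _≈_ = _≈±_ ; isEquivalence = ≈±-isEquivalence }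

S6Setoid : ℕ → Setoid _ _
S6Setoid n = On.setoid {B = Σ Triple (InS6 n)} TripleSetoid proj₁

-- A self-conjugate partition is a nest of diagonal hooks; if their arms are a₁ > a₂ > … > a_d it is
-- determined by D = {aᵢ} and has size Σ (2a + 1). Its hook lengths are a + a' + 1 (a, a' ∈ D) and
-- a − m (a ∈ D, m < a, m ∉ D), so it is a 6-core iff none of these is divisible by 6. On a
-- 6-abacus holding D this says: of the runners r and 5 − r of each pair {0,5}, {1,4}, {2,3} at
-- most one carries beads, and those form an initial segment. Recording the segment length, signed
-- by the runner, gives charges (c₀, c₁, c₂) ∈ ℤ³ in bijection with such D, and adding a bead a
-- changes (12c₂ − 1)² + (12c₁ − 3)² + (12c₀ − 5)² by exactly 24 (2a + 1), so this sum is 24 n + 35.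
-- Finally every x ≡ ±w (mod 12) is ±(12c − w) for a unique c, which absorbs the sign identification.

module Submission where

open import Defs
open import Data.Bool using (Bool; true; false; not) renaming (_≟_ to _≟ᵇ_)
open import Data.Bool.Properties using (¬-not)
open import Data.Empty using (⊥; ⊥-elim)
open import Data.Integer as ℤ using (ℤ; +_; -[1+_]; -_; ∣_∣)
import Data.Integer.Properties as ℤP
import Data.Integer.Tactic.RingSolver as ℤ-Solver
open import Data.List using (List; []; _∷_; length; filter; map; _++_; replicate; applyUpTo; _∷ʳ_)
open import Data.List.Properties
  using (applyUpTo-∷ʳ; map-applyUpTo; length-applyUpTo; filter-accept; filter-reject; filter-++; length-++; length-map; length-replicate)
open import Data.List.Membership.Propositional using (_∈_; _∉_)
open import Data.List.Relation.Unary.All as All using (All; []; _∷_)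
import Data.List.Relation.Unary.All.Properties as All
open import Data.List.Relation.Unary.AllPairs using (AllPairs; []; _∷_)
open import Data.List.Relation.Unary.Any using (here; there)
open import Data.List.Relation.Unary.Linked as Linked using (Linked; []; [-]; _∷_)
open import Data.Nat as ℕ using (ℕ; zero; suc; _+_; _*_; _∸_; _≤_; _<_; _≥_; _>_; _≤?_; _<?_; z≤n; s≤s)
open import Data.List.Membership.DecPropositional ℕ._≟_ using (_∈?_)
open import Data.Nat.Divisibility using (_∣_; divides)
import Data.Integer.Divisibility as ℤD
open import Data.Nat.ListAction using (sum)
open import Data.Nat.Properties
import Data.Nat.Tactic.RingSolver as ℕ-Solver
open import Data.Product as Prod using (Σ; _×_; _,_; proj₁; proj₂)
open import Data.Sum using (inj₁; inj₂)
open import Data.Unit using (⊤; tt)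
open import Function using (_∘_)
open import Function.Bundles using (Bijection)
open import Relation.Binary using (IsEquivalence; tri<; tri≈; tri>)
open import Relation.Binary.PropositionalEquality as ≡ using (_≡_; _≢_; refl; sym; trans; cong; cong₂; subst; subst₂)
open import Relation.Nullary using (¬_; yes; no; Dec)
open import Relation.Nullary.Decidable using (toWitness)

-- Residues modulo 6

data Res6 : Set where
  r0 r1 r2 r3 r4 r5 : Res6

suc₆ : Res6 → Res6
suc₆ r0 = r1
suc₆ r1 = r2
suc₆ r2 = r3
suc₆ r3 = r4
suc₆ r4 = r5
suc₆ r5 = r0

toℕ : Res6 → ℕ
toℕ r0 = 0
toℕ r1 = 1
toℕ r2 = 2
toℕ r3 = 3
toℕ r4 = 4
toℕ r5 = 5

toℕ<6 : ∀ r → toℕ r < 6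
toℕ<6 r0 = s≤s z≤n
toℕ<6 r1 = s≤s (s≤s z≤n)
toℕ<6 r2 = s≤s (s≤s (s≤s z≤n))
toℕ<6 r3 = s≤s (s≤s (s≤s (s≤s z≤n)))
toℕ<6 r4 = s≤s (s≤s (s≤s (s≤s (s≤s z≤n))))
toℕ<6 r5 = s≤s (s≤s (s≤s (s≤s (s≤s (s≤s z≤n)))))

rem6 : ℕ → Res6
rem6 zero    = r0
rem6 (suc n) = suc₆ (rem6 n)

carry : Res6 → ℕ → ℕ
carry r5 q = suc q
carry _  q = q

quot6 : ℕ → ℕ
quot6 zero    = 0
quot6 (suc n) = carry (rem6 n) (quot6 n)

n≡rem6+6*quot6 : ∀ n → n ≡ toℕ (rem6 n) + 6 * quot6 n
n≡rem6+6*quot6 zero    = refl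
n≡rem6+6*quot6 (suc n) = trans (cong suc (n≡rem6+6*quot6 n)) (suc-digit (rem6 n) (quot6 n))
  where
  suc-digit : ∀ r q → suc (toℕ r + 6 * q) ≡ toℕ (suc₆ r) + 6 * carry r q
  suc-digit r0 q = refl
  suc-digit r1 q = refl
  suc-digit r2 q = refl
  suc-digit r3 q = refl
  suc-digit r4 q = refl
  suc-digit r5 q = sym (*-suc 6 q)

rem6-quot6-injective : ∀ m n → rem6 m ≡ rem6 n → quot6 m ≡ quot6 n → m ≡ n
rem6-quot6-injective m n r≡ q≡ = begin
  m                             ≡⟨ n≡rem6+6*quot6 m ⟩
  toℕ (rem6 m) + 6 * quot6 m    ≡⟨ cong₂ (λ r q → toℕ r + 6 * q) r≡ q≡ ⟩
  toℕ (rem6 n) + 6 * quot6 n    ≡⟨ n≡rem6+6*quot6 n ⟨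
  n                             ∎
  where open ≡.≡-Reasoning

quot6-mono-< : ∀ m n → rem6 m ≡ rem6 n → m < n → quot6 m < quot6 n
quot6-mono-< m n r≡ m<n = *-cancelˡ-< 6 (quot6 m) (quot6 n) (+-cancelˡ-< (toℕ (rem6 n)) (6 * quot6 m) (6 * quot6 n)
  (subst (_< toℕ (rem6 n) + 6 * quot6 n) (trans (n≡rem6+6*quot6 m) (cong (λ r → toℕ r + 6 * quot6 m) r≡))
         (subst (m <_) (n≡rem6+6*quot6 n) m<n)))

_+₆_ : Res6 → Res6 → Res6
r0 +₆ s = s
r1 +₆ s = suc₆ s
r2 +₆ s = suc₆ (suc₆ s)
r3 +₆ s = suc₆ (suc₆ (suc₆ s))
r4 +₆ s = suc₆ (suc₆ (suc₆ (suc₆ s)))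
r5 +₆ s = suc₆ (suc₆ (suc₆ (suc₆ (suc₆ s))))

+₆-identityʳ : ∀ s → s +₆ r0 ≡ s
+₆-identityʳ r0 = refl
+₆-identityʳ r1 = refl
+₆-identityʳ r2 = refl
+₆-identityʳ r3 = refl
+₆-identityʳ r4 = refl
+₆-identityʳ r5 = refl

suc₆-periodic : ∀ r → suc₆ (suc₆ (suc₆ (suc₆ (suc₆ (suc₆ r))))) ≡ r
suc₆-periodic r0 = refl
suc₆-periodic r1 = refl
suc₆-periodic r2 = refl
suc₆-periodic r3 = refl
suc₆-periodic r4 = refl
suc₆-periodic r5 = refl

+₆-suc₆ˡ : ∀ r s → suc₆ r +₆ s ≡ suc₆ (r +₆ s)
+₆-suc₆ˡ r0 s = refl
+₆-suc₆ˡ r1 s = refl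
+₆-suc₆ˡ r2 s = refl
+₆-suc₆ˡ r3 s = refl
+₆-suc₆ˡ r4 s = refl
+₆-suc₆ˡ r5 s = sym (suc₆-periodic s)

rem6-+ : ∀ m n → rem6 (m + n) ≡ rem6 m +₆ rem6 n
rem6-+ zero    n = refl
rem6-+ (suc m) n = trans (cong suc₆ (rem6-+ m n)) (sym (+₆-suc₆ˡ (rem6 m) (rem6 n)))

rem6-*6 : ∀ q → rem6 (q * 6) ≡ r0
rem6-*6 zero    = refl
rem6-*6 (suc q) = trans (suc₆-periodic (rem6 (q * 6))) (rem6-*6 q)

6∣⇒rem6≡r0 : ∀ n → 6 ∣ n → rem6 n ≡ r0
6∣⇒rem6≡r0 n (divides q refl) = rem6-*6 q

rem6≡r0⇒6∣ : ∀ n → rem6 n ≡ r0 → 6 ∣ n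
rem6≡r0⇒6∣ n r≡ = divides (quot6 n) (trans (n≡rem6+6*quot6 n) (trans (cong (λ r → toℕ r + 6 * quot6 n) r≡) (*-comm 6 (quot6 n))))

rem6-toℕ : ∀ s → rem6 (toℕ s) ≡ s
rem6-toℕ r0 = refl
rem6-toℕ r1 = refl
rem6-toℕ r2 = refl
rem6-toℕ r3 = refl
rem6-toℕ r4 = refl
rem6-toℕ r5 = refl

rem6-toℕ+6* : ∀ s q → rem6 (toℕ s + 6 * q) ≡ s
rem6-toℕ+6* s q = begin
  rem6 (toℕ s + 6 * q)          ≡⟨ rem6-+ (toℕ s) (6 * q) ⟩
  rem6 (toℕ s) +₆ rem6 (6 * q)  ≡⟨ cong₂ _+₆_ (rem6-toℕ s) (trans (cong rem6 (*-comm 6 q)) (rem6-*6 q)) ⟩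
  s +₆ r0                       ≡⟨ +₆-identityʳ s ⟩
  s                             ∎
  where open ≡.≡-Reasoning

quot6-toℕ+6* : ∀ s q → quot6 (toℕ s + 6 * q) ≡ q
quot6-toℕ+6* s q = *-cancelˡ-≡ (quot6 n) q 6 (+-cancelˡ-≡ (toℕ s) (6 * quot6 n) (6 * q)
  (trans (cong (λ r → toℕ r + 6 * quot6 n) (sym (rem6-toℕ+6* s q))) (sym (n≡rem6+6*quot6 n))))
  where n = toℕ s + 6 * q

hook₆ : Res6 → Res6 → Res6
hook₆ r s = suc₆ (r +₆ s)

rem6-hook : ∀ a m → rem6 (a + m + 1) ≡ hook₆ (rem6 a) (rem6 m)
rem6-hook a m = trans (cong rem6 (+-comm (a + m) 1)) (cong suc₆ (rem6-+ a m))

hook₆-diagonal≢r0 : ∀ r → hook₆ r r ≢ r0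
hook₆-diagonal≢r0 r0 ()
hook₆-diagonal≢r0 r1 ()
hook₆-diagonal≢r0 r2 ()
hook₆-diagonal≢r0 r3 ()
hook₆-diagonal≢r0 r4 ()
hook₆-diagonal≢r0 r5 ()

6∤odd : ∀ a → ¬ 6 ∣ (a + a + 1)
6∤odd a 6∣ = hook₆-diagonal≢r0 (rem6 a) (trans (sym (rem6-hook a a)) (6∣⇒rem6≡r0 _ 6∣))

m+[1+d]∸[1+m]+1≡1+d : ∀ m d → (m + suc d) ∸ suc m + 1 ≡ suc d
m+[1+d]∸[1+m]+1≡1+d m d = trans (cong (λ z → z ∸ suc m + 1) (+-suc m d)) (trans (cong (_+ 1) (m+n∸m≡n m d)) (+-comm d 1))

6∣difference⇒rem6≡ : ∀ m n → m < n → 6 ∣ (n ∸ suc m + 1) → rem6 m ≡ rem6 n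
6∣difference⇒rem6≡ m n m<n 6∣ = sym (begin
  rem6 n                     ≡⟨ cong rem6 n≡m+[1+d] ⟩
  rem6 (m + suc d)           ≡⟨ rem6-+ m (suc d) ⟩
  rem6 m +₆ rem6 (suc d)     ≡⟨ cong (rem6 m +₆_) (6∣⇒rem6≡r0 (suc d) (subst (6 ∣_) n-m≡1+d 6∣)) ⟩
  rem6 m +₆ r0               ≡⟨ +₆-identityʳ (rem6 m) ⟩
  rem6 m                     ∎)
  where
  open ≡.≡-Reasoning
  d = n ∸ suc m
  n≡m+[1+d] : n ≡ m + suc d
  n≡m+[1+d] = sym (trans (+-suc m d) (m+[n∸m]≡n m<n))
  n-m≡1+d : n ∸ suc m + 1 ≡ suc d
  n-m≡1+d = trans (cong (λ z → z ∸ suc m + 1) n≡m+[1+d]) (m+[1+d]∸[1+m]+1≡1+d m d)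

-- Self-conjugate partitions as nests of diagonal hooks

-- 0-indexed parts: part₀ l i = part l (suc i), and conjPart₀ l k = conjPart l (suc k) definitionally.
part₀ : List ℕ → ℕ → ℕ
part₀ []       _       = 0
part₀ (x ∷ xs) zero    = x
part₀ (x ∷ xs) (suc i) = part₀ xs i

part-suc≡part₀ : ∀ l i → part l (suc i) ≡ part₀ l i
part-suc≡part₀ []       i       = refl
part-suc≡part₀ (x ∷ xs) zero    = refl
part-suc≡part₀ (x ∷ xs) (suc i) = part-suc≡part₀ xs i

part₀-beyond : ∀ l i → length l ≤ i → part₀ l i ≡ 0
part₀-beyond []       i       _       = refl
part₀-beyond (x ∷ xs) (suc i) (s≤s p) = part₀-beyond xs i p

part₀-positive⇒<length : ∀ l i → 0 < part₀ l i → i < length l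
part₀-positive⇒<length (x ∷ xs) zero    _ = s≤s z≤n
part₀-positive⇒<length (x ∷ xs) (suc i) p = s≤s (part₀-positive⇒<length xs i p)

conjPart₀ : List ℕ → ℕ → ℕ
conjPart₀ l k = length (filter (suc k ≤?_) l)

conjPart₀-∷-> : ∀ x l k → k < x → conjPart₀ (x ∷ l) k ≡ suc (conjPart₀ l k)
conjPart₀-∷-> x l k k<x = cong length (filter-accept (suc k ≤?_) k<x)

conjPart₀-∷-≤ : ∀ x l k → x ≤ k → conjPart₀ (x ∷ l) k ≡ conjPart₀ l k
conjPart₀-∷-≤ x l k x≤k = cong length (filter-reject (suc k ≤?_) (λ k<x → <-irrefl refl (≤-trans k<x x≤k)))

conjPart₀-zero : ∀ l → All (0 <_) l → conjPart₀ l 0 ≡ length l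
conjPart₀-zero []       []       = refl
conjPart₀-zero (x ∷ xs) (p ∷ ps) = trans (conjPart₀-∷-> x xs 0 p) (cong suc (conjPart₀-zero xs ps))

conjPart₀-all≤ : ∀ l k → All (_≤ k) l → conjPart₀ l k ≡ 0
conjPart₀-all≤ []      k []       = refl
conjPart₀-all≤ (x ∷ l) k (p ∷ ps) = trans (conjPart₀-∷-≤ x l k p) (conjPart₀-all≤ l k ps)

conjPart₀-map-suc : ∀ μ k → conjPart₀ (map suc μ) (suc k) ≡ conjPart₀ μ k
conjPart₀-map-suc []      k = refl
conjPart₀-map-suc (x ∷ μ) k with suc k ≤? x
... | yes p = trans (conjPart₀-∷-> (suc x) (map suc μ) (suc k) (s≤s p))
                    (trans (cong suc (conjPart₀-map-suc μ k)) (sym (conjPart₀-∷-> x μ k p)))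
... | no p  = trans (conjPart₀-∷-≤ (suc x) (map suc μ) (suc k) (s≤s (≮⇒≥ p)))
                    (trans (conjPart₀-map-suc μ k) (sym (conjPart₀-∷-≤ x μ k (≮⇒≥ p))))

conjPart₀-++ : ∀ xs ys k → conjPart₀ (xs ++ ys) k ≡ conjPart₀ xs k + conjPart₀ ys k
conjPart₀-++ xs ys k = trans (cong length (filter-++ (suc k ≤?_) xs ys)) (length-++ (filter (suc k ≤?_) xs))

part₀-replicate : ∀ r k → k < r → part₀ (replicate r 1) k ≡ 1
part₀-replicate (suc r) zero    _       = refl
part₀-replicate (suc r) (suc k) (s≤s p) = part₀-replicate r k p

linked-∷ : ∀ x l → part₀ l 0 ≤ x → Linked _≥_ l → Linked _≥_ (x ∷ l)
linked-∷ x []      _ _ = [-]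
linked-∷ x (y ∷ l) p L = p ∷ L

-- enclose a μ surrounds μ by a diagonal hook with arm and leg of length a (a partition when length μ ≤ a and μ₁ ≤ a)
enclosedRows : ℕ → List ℕ → List ℕ
enclosedRows a μ = map suc μ ++ replicate (a ∸ length μ) 1

enclose : ℕ → List ℕ → List ℕ
enclose a μ = suc a ∷ enclosedRows a μ

length-enclosedRows : ∀ a μ → length μ ≤ a → length (enclosedRows a μ) ≡ a
length-enclosedRows a μ μ≤a = begin
  length (map suc μ ++ replicate (a ∸ length μ) 1)         ≡⟨ length-++ (map suc μ) ⟩
  length (map suc μ) + length (replicate (a ∸ length μ) 1) ≡⟨ cong₂ _+_ (length-map suc μ) (length-replicate (a ∸ length μ)) ⟩
  length μ + (a ∸ length μ)                                ≡⟨ m+[n∸m]≡n μ≤a ⟩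
  a                                                        ∎
  where open ≡.≡-Reasoning

conjPart₀-enclosedRows : ∀ a μ k → conjPart₀ (enclosedRows a μ) (suc k) ≡ conjPart₀ μ k
conjPart₀-enclosedRows a μ k = begin
  conjPart₀ (map suc μ ++ replicate (a ∸ length μ) 1) (suc k)                   ≡⟨ conjPart₀-++ (map suc μ) _ (suc k) ⟩
  conjPart₀ (map suc μ) (suc k) + conjPart₀ (replicate (a ∸ length μ) 1) (suc k) ≡⟨ cong₂ _+_ (conjPart₀-map-suc μ k) (conjPart₀-all≤ _ (suc k) (All.replicate⁺ (a ∸ length μ) (s≤s z≤n))) ⟩
  conjPart₀ μ k + 0                                                               ≡⟨ +-identityʳ _ ⟩
  conjPart₀ μ k                                                                   ∎
  where open ≡.≡-Reasoning

part₀-enclosedRows-< : ∀ a μ k → length μ ≤ a → k < a → part₀ (enclosedRows a μ) k ≡ suc (part₀ μ k)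
part₀-enclosedRows-< a       []      k       _       k<a       = part₀-replicate a k k<a
part₀-enclosedRows-< (suc a) (x ∷ μ) zero    _       _         = refl
part₀-enclosedRows-< (suc a) (x ∷ μ) (suc k) (s≤s p) (s≤s k<a) = part₀-enclosedRows-< a μ k p k<a

part₀-enclosedRows-≥ : ∀ a μ k → length μ ≤ a → a ≤ k → part₀ (enclosedRows a μ) k ≡ 0
part₀-enclosedRows-≥ a μ k μ≤a a≤k = part₀-beyond (enclosedRows a μ) k (≤-trans (≤-reflexive (length-enclosedRows a μ μ≤a)) a≤k)

enclosedRows-positive : ∀ a μ → All (0 <_) (enclosedRows a μ)
enclosedRows-positive a μ = All.++⁺ (All.map⁺ (All.universal (λ _ → s≤s z≤n) μ)) (All.replicate⁺ (a ∸ length μ) (s≤s z≤n))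

enclosedRows-head≤ : ∀ a μ → length μ ≤ a → part₀ μ 0 ≤ a → part₀ (enclosedRows a μ) 0 ≤ suc a
enclosedRows-head≤ zero    μ μ≤a _  = ≤-trans (≤-reflexive (part₀-enclosedRows-≥ 0 μ 0 μ≤a z≤n)) z≤n
enclosedRows-head≤ (suc a) μ μ≤a μ₁≤a = ≤-trans (≤-reflexive (part₀-enclosedRows-< (suc a) μ 0 μ≤a (s≤s z≤n))) (s≤s μ₁≤a)

map-suc-++-ones-decreasing : ∀ μ r → Linked _≥_ μ → Linked _≥_ (map suc μ ++ replicate r 1)
map-suc-++-ones-decreasing []          zero          _       = []
map-suc-++-ones-decreasing []          (suc zero)    _       = [-]
map-suc-++-ones-decreasing []          (suc (suc r)) _       = ≤-refl ∷ map-suc-++-ones-decreasing [] (suc r) []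
map-suc-++-ones-decreasing (x ∷ [])    zero          _       = [-]
map-suc-++-ones-decreasing (x ∷ [])    (suc r)       _       = s≤s z≤n ∷ map-suc-++-ones-decreasing [] (suc r) []
map-suc-++-ones-decreasing (x ∷ y ∷ μ) r             (p ∷ L) = s≤s p ∷ map-suc-++-ones-decreasing (y ∷ μ) r L

sum-map-suc-++-ones : ∀ μ r → sum (map suc μ ++ replicate r 1) ≡ sum μ + length μ + r
sum-map-suc-++-ones []      zero    = refl
sum-map-suc-++-ones []      (suc r) = cong suc (sum-map-suc-++-ones [] r)
sum-map-suc-++-ones (x ∷ μ) r       = trans (cong (_+_ (suc x)) (sum-map-suc-++-ones μ r)) (shuffle x (sum μ) (length μ) r)
  where
  shuffle : ∀ x s l r → suc x + (s + l + r) ≡ x + s + suc l + r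
  shuffle = ℕ-Solver.solve-∀

sum-enclosedRows : ∀ a μ → length μ ≤ a → sum (enclosedRows a μ) ≡ sum μ + a
sum-enclosedRows a μ μ≤a = trans (sum-map-suc-++-ones μ (a ∸ length μ))
  (trans (+-assoc (sum μ) (length μ) _) (cong (_+_ (sum μ)) (m+[n∸m]≡n μ≤a)))

Symmetric : List ℕ → Set
Symmetric l = ∀ k → conjPart₀ l k ≡ part₀ l k

enclose-symmetric : ∀ a μ → length μ ≤ a → Symmetric μ → Symmetric (enclose a μ)
enclose-symmetric a μ μ≤a sym-μ zero =
  trans (conjPart₀-zero (enclose a μ) (s≤s z≤n ∷ enclosedRows-positive a μ)) (cong suc (length-enclosedRows a μ μ≤a))
enclose-symmetric a μ μ≤a sym-μ (suc k) with k <? a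
... | yes k<a = trans (conjPart₀-∷-> (suc a) (enclosedRows a μ) (suc k) (s≤s k<a))
                  (trans (cong suc (trans (conjPart₀-enclosedRows a μ k) (sym-μ k))) (sym (part₀-enclosedRows-< a μ k μ≤a k<a)))
... | no k≮a = trans (conjPart₀-∷-≤ (suc a) (enclosedRows a μ) (suc k) (s≤s a≤k))
                  (trans (conjPart₀-enclosedRows a μ k) (trans (sym-μ k)
                  (trans (part₀-beyond μ k (≤-trans μ≤a a≤k)) (sym (part₀-enclosedRows-≥ a μ k μ≤a a≤k)))))
  where a≤k = ≮⇒≥ k≮a

-- The self-conjugate partition whose diagonal hooks have arms D (listed from the outside in).
fromArms : List ℕ → List ℕ
fromArms []      = []
fromArms (a ∷ D) = enclose a (fromArms D)

width : List ℕ → ℕ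
width []      = 0
width (a ∷ _) = suc a

width≤ : ∀ a D → All (_< a) D → width D ≤ a
width≤ a []      _       = z≤n
width≤ a (b ∷ D) (p ∷ _) = p

hookSum : List ℕ → ℕ
hookSum []      = 0
hookSum (a ∷ D) = suc (a + a) + hookSum D

record FromArms (D : List ℕ) : Set where
  field
    length≡width  : length (fromArms D) ≡ width D
    head≡width    : part₀ (fromArms D) 0 ≡ width D
    decreasing    : Linked _≥_ (fromArms D)
    positive      : All (0 <_) (fromArms D)
    symmetric     : Symmetric (fromArms D)
    sum≡hookSum   : sum (fromArms D) ≡ hookSum D

fromArms-facts : ∀ D → AllPairs _>_ D → FromArms D
fromArms-facts []      _ = record
  { length≡width = refl ; head≡width = refl ; decreasing = [] ; positive = [] ; symmetric = λ k → refl ; sum≡hookSum = refl }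
fromArms-facts (a ∷ D) (D<a ∷ D↓) = record
  { length≡width = cong suc (length-enclosedRows a μ μ≤a)
  ; head≡width   = refl
  ; decreasing   = linked-∷ (suc a) (enclosedRows a μ)
                     (enclosedRows-head≤ a μ μ≤a (≤-trans (≤-reflexive (FromArms.head≡width I)) (width≤ a D D<a)))
                     (map-suc-++-ones-decreasing μ (a ∸ length μ) (FromArms.decreasing I))
  ; positive     = s≤s z≤n ∷ enclosedRows-positive a μ
  ; symmetric    = enclose-symmetric a μ μ≤a (FromArms.symmetric I)
  ; sum≡hookSum  = cong suc (trans (cong (_+_ a) (trans (sum-enclosedRows a μ μ≤a) (cong (_+ a) (FromArms.sum≡hookSum I))))
                                   (a+[s+a]≡a+a+s a (hookSum D)))
  }
  where
  I = fromArms-facts D D↓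
  μ = fromArms D
  μ≤a : length μ ≤ a
  μ≤a = ≤-trans (≤-reflexive (FromArms.length≡width I)) (width≤ a D D<a)
  a+[s+a]≡a+a+s : ∀ a s → a + (s + a) ≡ a + a + s
  a+[s+a]≡a+a+s = ℕ-Solver.solve-∀

length-fromArms≤ : ∀ a D → All (_< a) D → AllPairs _>_ D → length (fromArms D) ≤ a
length-fromArms≤ a D D<a D↓ = ≤-trans (≤-reflexive (FromArms.length≡width (fromArms-facts D D↓))) (width≤ a D D<a)

-- Hook lengths in terms of the arms

-- For symmetric l this is the hook length of the cell (i + 1 , k + 1).
hook₀ : List ℕ → ℕ → ℕ → ℕ
hook₀ l i k = (part₀ l i + part₀ l k) ∸ suc i ∸ suc k + 1

Core₀ : List ℕ → Set
Core₀ l = ∀ i k → k < part₀ l i → ¬ 6 ∣ hook₀ l i k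

-- rowHook a μ k + 1 is the hook length of the cell (1 , k + 2) of enclose a μ.
rowHook : ℕ → List ℕ → ℕ → ℕ
rowHook a μ k = (a + part₀ μ k) ∸ suc k

[1+x+1+y]∸[2+i]∸[2+k]≡[x+y]∸[1+i]∸[1+k] : ∀ x y i k → (suc x + suc y) ∸ suc (suc i) ∸ suc (suc k) ≡ (x + y) ∸ suc i ∸ suc k
[1+x+1+y]∸[2+i]∸[2+k]≡[x+y]∸[1+i]∸[1+k] x y i k = begin
  (x + suc y) ∸ suc i ∸ suc (suc k)   ≡⟨ cong (λ z → z ∸ suc i ∸ suc (suc k)) (+-suc x y) ⟩
  ((x + y) ∸ i) ∸ suc (suc k)         ≡⟨ ∸-+-assoc (x + y) i (suc (suc k)) ⟩
  (x + y) ∸ (i + suc (suc k))         ≡⟨ cong ((x + y) ∸_) (+-suc i (suc k)) ⟩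
  (x + y) ∸ (suc i + suc k)           ≡⟨ ∸-+-assoc (x + y) (suc i) (suc k) ⟨
  (x + y) ∸ suc i ∸ suc k             ∎
  where open ≡.≡-Reasoning

hook₀-enclose-corner : ∀ a μ → hook₀ (enclose a μ) 0 0 ≡ a + a + 1
hook₀-enclose-corner a μ = cong (λ z → z ∸ 1 + 1) (+-suc a a)

hook₀-enclose-row : ∀ a μ k → length μ ≤ a → k < a → hook₀ (enclose a μ) 0 (suc k) ≡ rowHook a μ k + 1
hook₀-enclose-row a μ k μ≤a k<a = trans
  (cong (λ u → (suc a + u) ∸ 1 ∸ suc (suc k) + 1) (part₀-enclosedRows-< a μ k μ≤a k<a))
  (cong (λ z → z ∸ suc (suc k) + 1) (+-suc a (part₀ μ k)))

hook₀-enclose-column : ∀ a μ i → length μ ≤ a → i < a → hook₀ (enclose a μ) (suc i) 0 ≡ rowHook a μ i + 1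
hook₀-enclose-column a μ i μ≤a i<a = trans
  (cong (λ u → (u + suc a) ∸ suc (suc i) ∸ 1 + 1) (part₀-enclosedRows-< a μ i μ≤a i<a))
  (cong (_+ 1) (begin
    (part₀ μ i + suc a) ∸ suc i ∸ 1   ≡⟨ cong (λ z → z ∸ suc i ∸ 1) (+-suc (part₀ μ i) a) ⟩
    (part₀ μ i + a) ∸ i ∸ 1           ≡⟨ ∸-+-assoc (part₀ μ i + a) i 1 ⟩
    (part₀ μ i + a) ∸ (i + 1)         ≡⟨ cong₂ _∸_ (+-comm (part₀ μ i) a) (+-comm i 1) ⟩
    (a + part₀ μ i) ∸ suc i           ∎))
  where open ≡.≡-Reasoning

hook₀-enclose-inner : ∀ a μ i k → length μ ≤ a → i < a → k < a → hook₀ (enclose a μ) (suc i) (suc k) ≡ hook₀ μ i k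
hook₀-enclose-inner a μ i k μ≤a i<a k<a = trans
  (cong₂ (λ u v → (u + v) ∸ suc (suc i) ∸ suc (suc k) + 1) (part₀-enclosedRows-< a μ i μ≤a i<a) (part₀-enclosedRows-< a μ k μ≤a k<a))
  (cong (_+ 1) ([1+x+1+y]∸[2+i]∸[2+k]≡[x+y]∸[1+i]∸[1+k] (part₀ μ i) (part₀ μ k) i k))

conjPart₀-∷-mono : ∀ x l k → conjPart₀ l k ≤ conjPart₀ (x ∷ l) k
conjPart₀-∷-mono x l k with suc k ≤? x
... | yes k<x = ≤-trans (n≤1+n _) (≤-reflexive (sym (conjPart₀-∷-> x l k k<x)))
... | no k≮x  = ≤-reflexive (sym (conjPart₀-∷-≤ x l k (≮⇒≥ k≮x)))

cell⇒conjPart₀-positive : ∀ μ i k → k < part₀ μ i → 0 < conjPart₀ μ k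
cell⇒conjPart₀-positive (x ∷ μ) zero    k k<x = ≤-trans (s≤s z≤n) (≤-reflexive (sym (conjPart₀-∷-> x μ k k<x)))
cell⇒conjPart₀-positive (x ∷ μ) (suc i) k cell = ≤-trans (cell⇒conjPart₀-positive μ i k cell) (conjPart₀-∷-mono x μ k)

cell⇒row<length : ∀ μ i k → k < part₀ μ i → i < length μ
cell⇒row<length μ i k cell = part₀-positive⇒<length μ i (≤-trans (s≤s z≤n) cell)

cell⇒column<length : ∀ μ i k → Symmetric μ → k < part₀ μ i → k < length μ
cell⇒column<length μ i k sym-μ cell =
  part₀-positive⇒<length μ k (≤-trans (cell⇒conjPart₀-positive μ i k cell) (≤-reflexive (sym-μ k)))

RowCore : ℕ → List ℕ → Set
RowCore a μ = ∀ k → k < a → ¬ 6 ∣ (rowHook a μ k + 1)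

enclose-Core₀⁻ : ∀ a μ → length μ ≤ a → Symmetric μ → Core₀ (enclose a μ) → Core₀ μ × RowCore a μ
enclose-Core₀⁻ a μ μ≤a sym-μ core = inner , row
  where
  inner : Core₀ μ
  inner i k cell 6∣ = core (suc i) (suc k) cell′ (subst (6 ∣_) (sym (hook₀-enclose-inner a μ i k μ≤a i<a k<a)) 6∣)
    where
    i<a = ≤-trans (cell⇒row<length μ i k cell) μ≤a
    k<a = ≤-trans (cell⇒column<length μ i k sym-μ cell) μ≤a
    cell′ = subst (suc k <_) (sym (part₀-enclosedRows-< a μ i μ≤a i<a)) (s≤s cell)
  row : RowCore a μ
  row k k<a 6∣ = core 0 (suc k) (s≤s k<a) (subst (6 ∣_) (sym (hook₀-enclose-row a μ k μ≤a k<a)) 6∣)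

enclose-Core₀⁺ : ∀ a μ → length μ ≤ a → Symmetric μ → Core₀ μ → RowCore a μ → Core₀ (enclose a μ)
enclose-Core₀⁺ a μ μ≤a sym-μ inner row zero zero _ 6∣ =
  6∤odd a (subst (6 ∣_) (hook₀-enclose-corner a μ) 6∣)
enclose-Core₀⁺ a μ μ≤a sym-μ inner row zero (suc k) (s≤s k<a) 6∣ =
  row k k<a (subst (6 ∣_) (hook₀-enclose-row a μ k μ≤a k<a) 6∣)
enclose-Core₀⁺ a μ μ≤a sym-μ inner row (suc i) k cell 6∣ with i <? a
... | no i≮a = <-irrefl refl (≤-trans (≤-trans (s≤s z≤n) cell) (≤-reflexive (part₀-enclosedRows-≥ a μ i μ≤a (≮⇒≥ i≮a))))
enclose-Core₀⁺ a μ μ≤a sym-μ inner row (suc i) zero _ 6∣ | yes i<a =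
  row i i<a (subst (6 ∣_) (hook₀-enclose-column a μ i μ≤a i<a) 6∣)
enclose-Core₀⁺ a μ μ≤a sym-μ inner row (suc i) (suc k) cell 6∣ | yes i<a =
  inner i k cell′ (subst (6 ∣_) (hook₀-enclose-inner a μ i k μ≤a i<a k<a) 6∣)
  where
  cell′ : k < part₀ μ i
  cell′ = ≤-pred (subst (suc k <_) (part₀-enclosedRows-< a μ i μ≤a i<a) cell)
  k<a = ≤-trans (cell⇒column<length μ i k sym-μ cell′) μ≤a

All<⇒∉ : ∀ {b m} D → All (_< b) D → b ≤ m → m ∉ D
All<⇒∉ (x ∷ D) (x<b ∷ _)  b≤m (here refl) = <-irrefl refl (≤-trans x<b b≤m)
All<⇒∉ (x ∷ D) (_ ∷ D<b) b≤m (there m∈D) = All<⇒∉ D D<b b≤m m∈D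

∉-∷ : ∀ {m b} D → m < b → m ∉ D → m ∉ (b ∷ D)
∉-∷ D m<b m∉D (here refl) = <-irrefl refl m<b
∉-∷ D m<b m∉D (there m∈D) = m∉D m∈D

module RowHookShift (N b : ℕ) (b<N : b < N) where
  d = N ∸ b

  d+b≡N : d + b ≡ N
  d+b≡N = m∸n+n≡m (<⇒≤ b<N)

  rowHook-enclose-zero : ∀ ν → rowHook N (enclose b ν) 0 ≡ N + b
  rowHook-enclose-zero ν = cong (_∸ 1) (+-suc N b)

  rowHook-enclose-< : ∀ ν k → length ν ≤ b → k < b → rowHook N (enclose b ν) (suc k) ≡ d + rowHook b ν k
  rowHook-enclose-< ν k ν≤b k<b = begin
    (N + part₀ (enclosedRows b ν) k) ∸ suc (suc k)   ≡⟨ cong (λ u → (N + u) ∸ suc (suc k)) (part₀-enclosedRows-< b ν k ν≤b k<b) ⟩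
    (N + suc q) ∸ suc (suc k)                        ≡⟨ cong (_∸ suc (suc k)) (+-suc N q) ⟩
    (N + q) ∸ suc k                                  ≡⟨ cong (λ u → (u + q) ∸ suc k) d+b≡N ⟨
    (d + b + q) ∸ suc k                              ≡⟨ cong (_∸ suc k) (+-assoc d b q) ⟩
    (d + (b + q)) ∸ suc k                            ≡⟨ +-∸-assoc d (≤-trans k<b (m≤m+n b q)) ⟩
    d + ((b + q) ∸ suc k)                            ∎
    where
    open ≡.≡-Reasoning
    q = part₀ ν k

  rowHook-enclose-≥ : ∀ ν k → length ν ≤ b → b ≤ k → rowHook N (enclose b ν) (suc k) ≡ N ∸ suc (suc k)
  rowHook-enclose-≥ ν k ν≤b b≤k =
    trans (cong (λ u → (N + u) ∸ suc (suc k)) (part₀-enclosedRows-≥ b ν k ν≤b b≤k)) (cong (_∸ suc (suc k)) (+-identityʳ N))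

  shift-arm : ∀ a → d + (b + a) ≡ N + a
  shift-arm a = trans (sym (+-assoc d b a)) (cong (_+ a) d+b≡N)

  shift-gap : ∀ m → m < b → d + (b ∸ suc m) ≡ N ∸ suc m
  shift-gap m m<b = trans (sym (+-∸-assoc d m<b)) (cong (_∸ suc m) d+b≡N)

-- Stated for an arbitrary P: the values rowHook N (fromArms D) k for k < N are exactly
-- N + a for the arms a ∈ D together with N ∸ suc m for the non-arms m < N.
rowHooks⇒armsAndGaps : ∀ D N (P : ℕ → Set) → AllPairs _>_ D → All (_< N) D →
  (∀ k → k < N → P (rowHook N (fromArms D) k)) →
  (∀ a → a ∈ D → P (N + a)) × (∀ m → m < N → m ∉ D → P (N ∸ suc m))
rowHooks⇒armsAndGaps [] N P _ _ hooks = (λ _ ()) , (λ m m<N _ → subst P (cong (_∸ suc m) (+-identityʳ N)) (hooks m m<N))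
rowHooks⇒armsAndGaps (b ∷ D) N P (D<b ∷ D↓) (b<N ∷ _) hooks = arms , gaps
  where
  open RowHookShift N b b<N
  ν = fromArms D
  ν≤b = length-fromArms≤ b D D<b D↓
  inner = rowHooks⇒armsAndGaps D b (λ v → P (d + v)) D↓ D<b
            (λ k k<b → subst P (rowHook-enclose-< ν k ν≤b k<b) (hooks (suc k) (≤-trans (s≤s k<b) b<N)))
  arms : ∀ a → a ∈ (b ∷ D) → P (N + a)
  arms a (here refl) = subst P (rowHook-enclose-zero ν) (hooks 0 (≤-trans (s≤s z≤n) b<N))
  arms a (there a∈D) = subst P (shift-arm a) (proj₁ inner a a∈D)
  gaps : ∀ m → m < N → m ∉ (b ∷ D) → P (N ∸ suc m)
  gaps m m<N m∉ with <-cmp m b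
  ... | tri< m<b _ _ = subst P (shift-gap m m<b) (proj₂ inner m m<b (λ m∈D → m∉ (there m∈D)))
  ... | tri≈ _ refl _ = ⊥-elim (m∉ (here refl))
  gaps (suc k) m<N m∉ | tri> _ _ (s≤s b≤k) = subst P (rowHook-enclose-≥ ν k ν≤b b≤k) (hooks (suc k) m<N)

armsAndGaps⇒rowHooks : ∀ D N (P : ℕ → Set) → AllPairs _>_ D → All (_< N) D →
  (∀ a → a ∈ D → P (N + a)) → (∀ m → m < N → m ∉ D → P (N ∸ suc m)) →
  ∀ k → k < N → P (rowHook N (fromArms D) k)
armsAndGaps⇒rowHooks [] N P _ _ arms gaps k k<N = subst P (cong (_∸ suc k) (sym (+-identityʳ N))) (gaps k k<N (λ ()))
armsAndGaps⇒rowHooks (b ∷ D) N P (D<b ∷ D↓) (b<N ∷ _) arms gaps zero _ =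
  subst P (sym (rowHook-enclose-zero (fromArms D))) (arms b (here refl))
  where open RowHookShift N b b<N
armsAndGaps⇒rowHooks (b ∷ D) N P (D<b ∷ D↓) (b<N ∷ _) arms gaps (suc k) k<N with k <? b
... | yes k<b = subst P (sym (rowHook-enclose-< (fromArms D) k ν≤b k<b))
                  (armsAndGaps⇒rowHooks D b (λ v → P (d + v)) D↓ D<b
                    (λ a a∈D → subst P (sym (shift-arm a)) (arms a (there a∈D)))
                    (λ m m<b m∉D → subst P (sym (shift-gap m m<b)) (gaps m (<-trans m<b b<N) (∉-∷ D m<b m∉D)))
                    k k<b)
  where
  open RowHookShift N b b<N
  ν≤b = length-fromArms≤ b D D<b D↓
... | no k≮b = subst P (sym (rowHook-enclose-≥ (fromArms D) k ν≤b b≤k)) (gaps (suc k) k<N 1+k∉)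
  where
  open RowHookShift N b b<N
  ν≤b = length-fromArms≤ b D D<b D↓
  b≤k = ≮⇒≥ k≮b
  1+k∉ : suc k ∉ (b ∷ D)
  1+k∉ (here 1+k≡b) = <-irrefl (sym 1+k≡b) (s≤s b≤k)
  1+k∉ (there 1+k∈D) = All<⇒∉ D D<b (≤-trans b≤k (n≤1+n k)) 1+k∈D

-- The 6-core condition on the arms of a self-conjugate partition: the hook lengths are
-- a + a' + 1 for arms a, a' and a ∸ m for an arm a and a non-arm m < a.
CoreArms : List ℕ → Set
CoreArms []      = ⊤
CoreArms (a ∷ D) = CoreArms D × (∀ a' → a' ∈ D → ¬ 6 ∣ (a + a' + 1)) × (∀ m → m < a → m ∉ D → ¬ 6 ∣ (a ∸ suc m + 1))

Core₀⇒CoreArms : ∀ D → AllPairs _>_ D → Core₀ (fromArms D) → CoreArms D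
Core₀⇒CoreArms []      _          _    = tt
Core₀⇒CoreArms (a ∷ D) (D<a ∷ D↓) core =
  Core₀⇒CoreArms D D↓ (proj₁ split) , rowHooks⇒armsAndGaps D a (λ v → ¬ 6 ∣ (v + 1)) D↓ D<a (proj₂ split)
  where
  split = enclose-Core₀⁻ a (fromArms D) (length-fromArms≤ a D D<a D↓) (FromArms.symmetric (fromArms-facts D D↓)) core

CoreArms⇒Core₀ : ∀ D → AllPairs _>_ D → CoreArms D → Core₀ (fromArms D)
CoreArms⇒Core₀ []      _          _                     i k ()
CoreArms⇒Core₀ (a ∷ D) (D<a ∷ D↓) (coreD , arms , gaps) =
  enclose-Core₀⁺ a (fromArms D) (length-fromArms≤ a D D<a D↓) (FromArms.symmetric (fromArms-facts D D↓))
    (CoreArms⇒Core₀ D D↓ coreD) (armsAndGaps⇒rowHooks D a (λ v → ¬ 6 ∣ (v + 1)) D↓ D<a arms gaps)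

-- Recovering the arms

oneTo≡applyUpTo-suc : ∀ m → oneTo m ≡ applyUpTo suc m
oneTo≡applyUpTo-suc zero    = refl
oneTo≡applyUpTo-suc (suc m) = trans (cong (_∷ʳ suc m) (oneTo≡applyUpTo-suc m)) (applyUpTo-∷ʳ suc m)

conjugate≡applyUpTo : ∀ l → conjugate l ≡ applyUpTo (conjPart₀ l) (largest l)
conjugate≡applyUpTo l =
  trans (cong (map (conjPart l)) (oneTo≡applyUpTo-suc (largest l))) (map-applyUpTo suc (conjPart l) (largest l))

part₀-applyUpTo : ∀ g n k → k < n → part₀ (applyUpTo g n) k ≡ g k
part₀-applyUpTo g (suc n) zero    _       = refl
part₀-applyUpTo g (suc n) (suc k) (s≤s p) = part₀-applyUpTo (g ∘ suc) n k p

applyUpTo-part₀ : ∀ l g → (∀ k → k < length l → g k ≡ part₀ l k) → applyUpTo g (length l) ≡ l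
applyUpTo-part₀ []      g _ = refl
applyUpTo-part₀ (x ∷ l) g h = cong₂ _∷_ (h 0 (s≤s z≤n)) (applyUpTo-part₀ l (g ∘ suc) (λ k p → h (suc k) (s≤s p)))

part₀-zero≡largest : ∀ l → part₀ l 0 ≡ largest l
part₀-zero≡largest []      = refl
part₀-zero≡largest (x ∷ l) = refl

all≤largest : ∀ l → Linked _≥_ l → All (_≤ largest l) l
all≤largest []          _       = []
all≤largest (x ∷ [])    _       = ≤-refl ∷ []
all≤largest (x ∷ y ∷ l) (p ∷ L) = ≤-refl ∷ All.map (λ q → ≤-trans q p) (all≤largest (y ∷ l) L)

SelfConjugate⇒Symmetric : ∀ l → Linked _≥_ l → SelfConjugate l → Symmetric l
SelfConjugate⇒Symmetric l L self k with k <? largest l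
... | yes k<λ₁ = trans (sym (part₀-applyUpTo (conjPart₀ l) (largest l) k k<λ₁)) (cong (λ z → part₀ z k) self′)
  where self′ = trans (sym (conjugate≡applyUpTo l)) self
... | no k≮λ₁ = trans (conjPart₀-all≤ l k (All.map (λ q → ≤-trans q λ₁≤k) (all≤largest l L)))
                  (sym (trans (cong (λ z → part₀ z k) (sym self′))
                    (part₀-beyond (applyUpTo (conjPart₀ l) (largest l)) k
                      (≤-trans (≤-reflexive (length-applyUpTo (conjPart₀ l) (largest l))) λ₁≤k))))
  where
  self′ = trans (sym (conjugate≡applyUpTo l)) self
  λ₁≤k = ≮⇒≥ k≮λ₁

Symmetric⇒SelfConjugate : ∀ l → All (0 <_) l → Symmetric l → SelfConjugate l
Symmetric⇒SelfConjugate l pos sym-l =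
  trans (conjugate≡applyUpTo l) (trans (cong (applyUpTo (conjPart₀ l)) (sym ℓ≡λ₁)) (applyUpTo-part₀ l (conjPart₀ l) (λ k _ → sym-l k)))
  where
  ℓ≡λ₁ : length l ≡ largest l
  ℓ≡λ₁ = trans (sym (conjPart₀-zero l pos)) (trans (sym-l 0) (part₀-zero≡largest l))

hook≡hook₀ : ∀ l i k → Symmetric l → hook l (suc i) (suc k) ≡ hook₀ l i k
hook≡hook₀ l i k sym-l = cong₂ (λ u v → (u + v) ∸ suc i ∸ suc k + 1) (part-suc≡part₀ l i) (sym-l k)

Core₀⇒IsCore : ∀ l → Symmetric l → Core₀ l → IsCore 6 l
Core₀⇒IsCore l sym-l core (suc i) (suc k) (_ , _ , _ , cell) 6∣ =
  core i k (subst (suc k ≤_) (part-suc≡part₀ l i) cell) (subst (6 ∣_) (hook≡hook₀ l i k sym-l) 6∣)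

IsCore⇒Core₀ : ∀ l → Symmetric l → IsCore 6 l → Core₀ l
IsCore⇒Core₀ l sym-l core i k cell 6∣ =
  core (suc i) (suc k) (s≤s z≤n , cell⇒row<length l i k cell , s≤s z≤n , subst (suc k ≤_) (sym (part-suc≡part₀ l i)) cell)
    (subst (6 ∣_) (sym (hook≡hook₀ l i k sym-l)) 6∣)

dropFirstColumn : List ℕ → List ℕ
dropFirstColumn r = map ℕ.pred (filter (2 ≤?_) r)

dropFirstColumn-∷-≥2 : ∀ y r → 2 ≤ y → dropFirstColumn (y ∷ r) ≡ ℕ.pred y ∷ dropFirstColumn r
dropFirstColumn-∷-≥2 y r 2≤y = cong (map ℕ.pred) (filter-accept (2 ≤?_) 2≤y)

dropFirstColumn-∷-1 : ∀ r → dropFirstColumn (1 ∷ r) ≡ dropFirstColumn r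
dropFirstColumn-∷-1 r = cong (map ℕ.pred) (filter-reject (2 ≤?_) {1} {r} λ { (s≤s ()) })

dropFirstColumn-ones : ∀ r → Linked _≥_ (1 ∷ r) → All (0 <_) r →
  dropFirstColumn (1 ∷ r) ≡ [] × 1 ∷ r ≡ replicate (length (1 ∷ r)) 1
dropFirstColumn-ones []            _               _       = refl , refl
dropFirstColumn-ones (suc zero ∷ r) (_ ∷ L)        (_ ∷ P) =
  trans (dropFirstColumn-∷-1 (1 ∷ r)) (proj₁ rest) , cong (1 ∷_) (proj₂ rest)
  where rest = dropFirstColumn-ones r L P
dropFirstColumn-ones (suc (suc _) ∷ r) (s≤s () ∷ _) _

head-tail≤ : ∀ y r → Linked _≥_ (y ∷ r) → part₀ r 0 ≤ y
head-tail≤ y []      _       = z≤n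
head-tail≤ y (z ∷ r) (p ∷ _) = p

record DropFirstColumn (r : List ℕ) : Set where
  field
    reassemble : r ≡ map suc (dropFirstColumn r) ++ replicate (length r ∸ length (dropFirstColumn r)) 1
    decreasing : Linked _≥_ (dropFirstColumn r)
    positive   : All (0 <_) (dropFirstColumn r)
    length≤    : length (dropFirstColumn r) ≤ length r
    head≤      : part₀ (dropFirstColumn r) 0 ≤ ℕ.pred (part₀ r 0)

dropFirstColumn-facts : ∀ r → Linked _≥_ r → All (0 <_) r → DropFirstColumn r
dropFirstColumn-facts [] _ _ = record { reassemble = refl ; decreasing = [] ; positive = [] ; length≤ = z≤n ; head≤ = z≤n }
dropFirstColumn-facts (suc zero ∷ r) L (_ ∷ P) = record
  { reassemble = trans ones (cong (λ u → map suc u ++ replicate (length (1 ∷ r) ∸ length u) 1) (sym dropped≡[]))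
  ; decreasing = subst (Linked _≥_) (sym dropped≡[]) []
  ; positive   = subst (All (0 <_)) (sym dropped≡[]) []
  ; length≤    = subst (λ u → length u ≤ length (1 ∷ r)) (sym dropped≡[]) z≤n
  ; head≤      = subst (λ u → part₀ u 0 ≤ 0) (sym dropped≡[]) z≤n
  }
  where
  dropped≡[] = proj₁ (dropFirstColumn-ones r L P)
  ones = proj₂ (dropFirstColumn-ones r L P)
dropFirstColumn-facts (suc (suc y) ∷ r) L (_ ∷ P) = record
  { reassemble = trans (cong (suc (suc y) ∷_) (DropFirstColumn.reassemble I))
                   (cong (λ u → map suc u ++ replicate (length r ∸ length (dropFirstColumn r)) 1) (sym dropped))
  ; decreasing = subst (Linked _≥_) (sym dropped)
                   (linked-∷ (suc y) (dropFirstColumn r) (≤-trans (DropFirstColumn.head≤ I) (pred-mono-≤ (head-tail≤ (suc (suc y)) r L)))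
                     (DropFirstColumn.decreasing I))
  ; positive   = subst (All (0 <_)) (sym dropped) (s≤s z≤n ∷ DropFirstColumn.positive I)
  ; length≤    = subst (λ u → length u ≤ length (suc (suc y) ∷ r)) (sym dropped) (s≤s (DropFirstColumn.length≤ I))
  ; head≤      = subst (λ u → part₀ u 0 ≤ suc y) (sym dropped) ≤-refl
  }
  where
  I = dropFirstColumn-facts r (Linked.tail L) P
  dropped = dropFirstColumn-∷-≥2 (suc (suc y)) r (s≤s (s≤s z≤n))

dropFirstColumn-map-suc-++-ones : ∀ μ r → All (0 <_) μ → dropFirstColumn (map suc μ ++ replicate r 1) ≡ μ
dropFirstColumn-map-suc-++-ones []      zero    _       = refl
dropFirstColumn-map-suc-++-ones []      (suc r) _       = trans (dropFirstColumn-∷-1 (replicate r 1)) (dropFirstColumn-map-suc-++-ones [] r [])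
dropFirstColumn-map-suc-++-ones (x ∷ μ) r       (p ∷ P) =
  trans (dropFirstColumn-∷-≥2 (suc x) _ (s≤s p)) (cong (x ∷_) (dropFirstColumn-map-suc-++-ones μ r P))

-- Reads off the arms of the diagonal hooks, from the outside in; the fuel f bounds their number.
toArms : ℕ → List ℕ → List ℕ
toArms zero    _       = []
toArms (suc f) []      = []
toArms (suc f) (x ∷ r) = ℕ.pred x ∷ toArms f (dropFirstColumn r)

toArms-[] : ∀ f → toArms f [] ≡ []
toArms-[] zero    = refl
toArms-[] (suc f) = refl

length≤width : ∀ D → AllPairs _>_ D → length D ≤ width D
length≤width []      _          = z≤n
length≤width (a ∷ D) (D<a ∷ D↓) = s≤s (≤-trans (length≤width D D↓) (width≤ a D D<a))

width≤⇒All< : ∀ D a → AllPairs _>_ D → width D ≤ a → All (_< a) D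
width≤⇒All< []      a _          _   = []
width≤⇒All< (b ∷ D) a (D<b ∷ D↓) b<a = b<a ∷ All.map (λ c<b → <-trans c<b b<a) D<b

toArms-fromArms : ∀ f D → AllPairs _>_ D → length D ≤ f → toArms f (fromArms D) ≡ D
toArms-fromArms f       []      _          _         = toArms-[] f
toArms-fromArms (suc f) (a ∷ D) (D<a ∷ D↓) (s≤s D≤f) = cong (a ∷_) (trans
  (cong (toArms f) (dropFirstColumn-map-suc-++-ones (fromArms D) _ (FromArms.positive (fromArms-facts D D↓))))
  (toArms-fromArms f D D↓ D≤f))

enclose⁻-symmetric : ∀ a μ → length μ ≤ a → Symmetric (enclose a μ) → Symmetric μ
enclose⁻-symmetric a μ μ≤a sym-aμ k with k <? a
... | yes k<a = suc-injective (begin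
  suc (conjPart₀ μ k)                        ≡⟨ cong suc (conjPart₀-enclosedRows a μ k) ⟨
  suc (conjPart₀ (enclosedRows a μ) (suc k)) ≡⟨ conjPart₀-∷-> (suc a) (enclosedRows a μ) (suc k) (s≤s k<a) ⟨
  conjPart₀ (enclose a μ) (suc k)            ≡⟨ sym-aμ (suc k) ⟩
  part₀ (enclosedRows a μ) k                 ≡⟨ part₀-enclosedRows-< a μ k μ≤a k<a ⟩
  suc (part₀ μ k)                            ∎)
  where open ≡.≡-Reasoning
... | no k≮a = begin
  conjPart₀ μ k                              ≡⟨ conjPart₀-enclosedRows a μ k ⟨
  conjPart₀ (enclosedRows a μ) (suc k)       ≡⟨ conjPart₀-∷-≤ (suc a) (enclosedRows a μ) (suc k) (s≤s a≤k) ⟨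
  conjPart₀ (enclose a μ) (suc k)            ≡⟨ sym-aμ (suc k) ⟩
  part₀ (enclosedRows a μ) k                 ≡⟨ part₀-enclosedRows-≥ a μ k μ≤a a≤k ⟩
  0                                          ≡⟨ part₀-beyond μ k (≤-trans μ≤a a≤k) ⟨
  part₀ μ k                                  ∎
  where
  open ≡.≡-Reasoning
  a≤k = ≮⇒≥ k≮a

fromArms-toArms : ∀ f l → Linked _≥_ l → All (0 <_) l → Symmetric l → length l ≤ f →
  AllPairs _>_ (toArms f l) × fromArms (toArms f l) ≡ l
fromArms-toArms f       []          _ _       _     _         = subst (λ u → AllPairs _>_ u × fromArms u ≡ []) (sym (toArms-[] f)) ([] , refl)
fromArms-toArms (suc f) (suc a ∷ r) L (_ ∷ P) sym-l (s≤s r≤f) =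
  (width≤⇒All< D a D↓ width≤a ∷ D↓) , cong (suc a ∷_) (trans (cong (enclosedRows a) fromArms-D) (sym r≡enclosed))
  where
  split = dropFirstColumn-facts r (Linked.tail L) P
  μ = dropFirstColumn r
  length-r : length r ≡ a
  length-r = suc-injective (trans (sym (conjPart₀-zero (suc a ∷ r) (s≤s z≤n ∷ P))) (sym-l 0))
  r≡enclosed : r ≡ enclosedRows a μ
  r≡enclosed = trans (DropFirstColumn.reassemble split) (cong (λ z → map suc μ ++ replicate (z ∸ length μ) 1) length-r)
  μ≤a : length μ ≤ a
  μ≤a = ≤-trans (DropFirstColumn.length≤ split) (≤-reflexive length-r)
  sym-μ : Symmetric μ
  sym-μ = enclose⁻-symmetric a μ μ≤a (subst (λ z → Symmetric (suc a ∷ z)) r≡enclosed sym-l)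
  inner = fromArms-toArms f μ (DropFirstColumn.decreasing split) (DropFirstColumn.positive split) sym-μ
            (≤-trans μ≤a (≤-trans (≤-reflexive (sym length-r)) r≤f))
  D = toArms f μ
  D↓ = proj₁ inner
  fromArms-D = proj₂ inner
  width≤a : width D ≤ a
  width≤a = ≤-trans (≤-reflexive (trans (sym (FromArms.length≡width (fromArms-facts D D↓))) (cong length fromArms-D))) μ≤a

-- The 6-abacus

-- The residue pairs {r , 5 - r}: a hook length a + a' + 1 is divisible by 6 exactly when a and a'
-- lie on the two different runners of one pair.
data Pair : Set where
  p05 p14 p23 : Pair

_≟ᵖ_ : (i j : Pair) → Dec (i ≡ j)
p05 ≟ᵖ p05 = yes refl
p14 ≟ᵖ p14 = yes refl
p23 ≟ᵖ p23 = yes refl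
p05 ≟ᵖ p14 = no λ ()
p05 ≟ᵖ p23 = no λ ()
p14 ≟ᵖ p05 = no λ ()
p14 ≟ᵖ p23 = no λ ()
p23 ≟ᵖ p05 = no λ ()
p23 ≟ᵖ p14 = no λ ()

pairOf : Res6 → Pair
pairOf r0 = p05
pairOf r5 = p05
pairOf r1 = p14
pairOf r4 = p14
pairOf r2 = p23
pairOf r3 = p23

side : Res6 → Bool
side r0 = true
side r1 = true
side r2 = true
side r3 = false
side r4 = false
side r5 = false

residue : Pair → Bool → Res6
residue p05 true  = r0
residue p05 false = r5
residue p14 true  = r1
residue p14 false = r4
residue p23 true  = r2
residue p23 false = r3

residue-pairOf-side : ∀ r → residue (pairOf r) (side r) ≡ r
residue-pairOf-side r0 = refl
residue-pairOf-side r1 = refl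
residue-pairOf-side r2 = refl
residue-pairOf-side r3 = refl
residue-pairOf-side r4 = refl
residue-pairOf-side r5 = refl

pairOf-residue : ∀ i σ → pairOf (residue i σ) ≡ i
pairOf-residue p05 true  = refl
pairOf-residue p05 false = refl
pairOf-residue p14 true  = refl
pairOf-residue p14 false = refl
pairOf-residue p23 true  = refl
pairOf-residue p23 false = refl

side-residue : ∀ i σ → side (residue i σ) ≡ σ
side-residue p05 true  = refl
side-residue p05 false = refl
side-residue p14 true  = refl
side-residue p14 false = refl
side-residue p23 true  = refl
side-residue p23 false = refl

pairOf-side-injective : ∀ r s → pairOf r ≡ pairOf s → side r ≡ side s → r ≡ s
pairOf-side-injective r s p≡ σ≡ =
  trans (sym (residue-pairOf-side r)) (trans (cong₂ residue p≡ σ≡) (residue-pairOf-side s))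

partner : Res6 → Res6
partner r = residue (pairOf r) (not (side r))

hook₆-partner : ∀ r → hook₆ r (partner r) ≡ r0
hook₆-partner r0 = refl
hook₆-partner r1 = refl
hook₆-partner r2 = refl
hook₆-partner r3 = refl
hook₆-partner r4 = refl
hook₆-partner r5 = refl

hook₆≡r0⇒partner : ∀ r s → hook₆ r s ≡ r0 → s ≡ partner r
hook₆≡r0⇒partner r0 r0 ()
hook₆≡r0⇒partner r0 r1 ()
hook₆≡r0⇒partner r0 r2 ()
hook₆≡r0⇒partner r0 r3 ()
hook₆≡r0⇒partner r0 r4 ()
hook₆≡r0⇒partner r0 r5 _  = refl
hook₆≡r0⇒partner r1 r0 ()
hook₆≡r0⇒partner r1 r1 ()
hook₆≡r0⇒partner r1 r2 ()
hook₆≡r0⇒partner r1 r3 ()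
hook₆≡r0⇒partner r1 r4 _  = refl
hook₆≡r0⇒partner r1 r5 ()
hook₆≡r0⇒partner r2 r0 ()
hook₆≡r0⇒partner r2 r1 ()
hook₆≡r0⇒partner r2 r2 ()
hook₆≡r0⇒partner r2 r3 _  = refl
hook₆≡r0⇒partner r2 r4 ()
hook₆≡r0⇒partner r2 r5 ()
hook₆≡r0⇒partner r3 r0 ()
hook₆≡r0⇒partner r3 r1 ()
hook₆≡r0⇒partner r3 r2 _  = refl
hook₆≡r0⇒partner r3 r3 ()
hook₆≡r0⇒partner r3 r4 ()
hook₆≡r0⇒partner r3 r5 ()
hook₆≡r0⇒partner r4 r0 ()
hook₆≡r0⇒partner r4 r1 _  = refl
hook₆≡r0⇒partner r4 r2 ()
hook₆≡r0⇒partner r4 r3 ()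
hook₆≡r0⇒partner r4 r4 ()
hook₆≡r0⇒partner r4 r5 ()
hook₆≡r0⇒partner r5 r0 _  = refl
hook₆≡r0⇒partner r5 r1 ()
hook₆≡r0⇒partner r5 r2 ()
hook₆≡r0⇒partner r5 r3 ()
hook₆≡r0⇒partner r5 r4 ()
hook₆≡r0⇒partner r5 r5 ()

Charges : Set
Charges = ℤ × ℤ × ℤ

charge : Charges → Pair → ℤ
charge (x , y , z) p05 = x
charge (x , y , z) p14 = y
charge (x , y , z) p23 = z

adjust : Charges → Pair → (ℤ → ℤ) → Charges
adjust (x , y , z) p05 f = (f x , y , z)
adjust (x , y , z) p14 f = (x , f y , z)
adjust (x , y , z) p23 f = (x , y , f z)

charge-adjust-≡ : ∀ c i f → charge (adjust c i f) i ≡ f (charge c i)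
charge-adjust-≡ (x , y , z) p05 f = refl
charge-adjust-≡ (x , y , z) p14 f = refl
charge-adjust-≡ (x , y , z) p23 f = refl

charge-adjust-≢ : ∀ c i j f → j ≢ i → charge (adjust c i f) j ≡ charge c j
charge-adjust-≢ c           p05 p05 f j≢i = ⊥-elim (j≢i refl)
charge-adjust-≢ c           p14 p14 f j≢i = ⊥-elim (j≢i refl)
charge-adjust-≢ c           p23 p23 f j≢i = ⊥-elim (j≢i refl)
charge-adjust-≢ (x , y , z) p05 p14 f _   = refl
charge-adjust-≢ (x , y , z) p05 p23 f _   = refl
charge-adjust-≢ (x , y , z) p14 p05 f _   = refl
charge-adjust-≢ (x , y , z) p14 p23 f _   = refl
charge-adjust-≢ (x , y , z) p23 p05 f _   = refl
charge-adjust-≢ (x , y , z) p23 p14 f _   = refl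

-- Abacus encoding: a pair with charge + k carries beads at levels 0 … k - 1 on its
-- side-true runner, one with charge -[1+ k ] at levels 0 … k on its side-false runner.
Bead : Bool → ℕ → ℤ → Set
Bead true  q (+ k)    = q < k
Bead true  q -[1+ k ] = ⊥
Bead false q (+ k)    = ⊥
Bead false q -[1+ k ] = q ≤ k

Bead? : ∀ σ q z → Dec (Bead σ q z)
Bead? true  q (+ k)    = q <? k
Bead? true  q -[1+ k ] = no λ ()
Bead? false q (+ k)    = no λ ()
Bead? false q -[1+ k ] = q ≤? k

BeadAt : Charges → Res6 → ℕ → Set
BeadAt c s q = Bead (side s) q (charge c (pairOf s))

BeadAt-cong : ∀ {c r s q q′} → r ≡ s → q ≡ q′ → BeadAt c r q → BeadAt c s q′
BeadAt-cong refl refl b = b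

_∈ᶜ_ : ℕ → Charges → Set
m ∈ᶜ c = BeadAt c (rem6 m) (quot6 m)

_∈ᶜ?_ : ∀ m c → Dec (m ∈ᶜ c)
m ∈ᶜ? c = Bead? (side (rem6 m)) (quot6 m) (charge c (pairOf (rem6 m)))

toℕ-residue+6*∈ᶜ⇒Bead : ∀ c i σ q → (toℕ (residue i σ) + 6 * q) ∈ᶜ c → Bead σ q (charge c i)
toℕ-residue+6*∈ᶜ⇒Bead c i σ q m∈c = subst₂ (λ τ j → Bead τ q (charge c j)) (side-residue i σ) (pairOf-residue i σ)
  (BeadAt-cong {c} (rem6-toℕ+6* (residue i σ) q) (quot6-toℕ+6* (residue i σ) q) m∈c)

Bead⇒toℕ-residue+6*∈ᶜ : ∀ c i σ q → Bead σ q (charge c i) → (toℕ (residue i σ) + 6 * q) ∈ᶜ c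
Bead⇒toℕ-residue+6*∈ᶜ c i σ q b = BeadAt-cong {c} (sym (rem6-toℕ+6* (residue i σ) q)) (sym (quot6-toℕ+6* (residue i σ) q))
  (subst₂ (λ τ j → Bead τ q (charge c j)) (sym (side-residue i σ)) (sym (pairOf-residue i σ)) b)

push : Bool → ℤ → ℤ
push true  z = ℤ.suc z
push false z = ℤ.pred z

fill : Bool → ℕ → ℤ
fill true  q = + q
fill false q = - (+ q)

push-fill : ∀ σ q → push σ (fill σ q) ≡ fill σ (suc q)
push-fill true  q       = refl
push-fill false zero    = refl
push-fill false (suc q) = refl

Bead-fill⇒< : ∀ σ q q′ → Bead σ q′ (fill σ q) → q′ < q
Bead-fill⇒< true  q       q′ b = b
Bead-fill⇒< false (suc q) q′ b = s≤s b

<⇒Bead-fill : ∀ σ q q′ → q′ < q → Bead σ q′ (fill σ q)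
<⇒Bead-fill true  q       q′ q′<q       = q′<q
<⇒Bead-fill false (suc q) q′ (s≤s q′≤q) = q′≤q

¬Bead-fill-not : ∀ σ q q′ → ¬ Bead (not σ) q′ (fill σ q)
¬Bead-fill-not true  q       q′ ()
¬Bead-fill-not false zero    q′ ()
¬Bead-fill-not false (suc q) q′ ()

Bead⇒¬Bead-not : ∀ σ q q′ z → Bead σ q z → ¬ Bead (not σ) q′ z
Bead⇒¬Bead-not true  q q′ (+ k)    _ ()
Bead⇒¬Bead-not false q q′ -[1+ k ] _ ()

Bead-≤ : ∀ σ q q′ z → Bead σ q z → q′ ≤ q → Bead σ q′ z
Bead-≤ true  q q′ (+ k)    q<k  q′≤q = ≤-<-trans q′≤q q<k
Bead-≤ false q q′ -[1+ k ] q≤k  q′≤q = ≤-trans q′≤q q≤k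

charge≡fill : ∀ σ q z → (∀ q′ → q′ < q → Bead σ q′ z) → ¬ Bead σ q z → ¬ Bead (not σ) 0 z → z ≡ fill σ q
charge≡fill true  q       (+ k)      below ¬at _     = cong +_ (≤-antisym (≮⇒≥ ¬at) (q≤k q below))
  where
  q≤k : ∀ q → (∀ q′ → q′ < q → q′ < k) → q ≤ k
  q≤k zero    _     = z≤n
  q≤k (suc q) below = below q ≤-refl
charge≡fill true  q       -[1+ k ]   _     _   ¬opp = ⊥-elim (¬opp z≤n)
charge≡fill false zero    (+ zero)   _     _   _    = refl
charge≡fill false (suc q) (+ zero)   below _   _    = ⊥-elim (below 0 (s≤s z≤n))
charge≡fill false q       (+ suc k)  _     _   ¬opp = ⊥-elim (¬opp (s≤s z≤n))
charge≡fill false zero    -[1+ k ]   _     ¬at _    = ⊥-elim (¬at z≤n)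
charge≡fill false (suc q) -[1+ k ]   below ¬at _    = cong -[1+_] (≤-antisym (≤-pred (≰⇒> ¬at)) (below q ≤-refl))

charges : List ℕ → Charges
charges []      = (+ 0 , + 0 , + 0)
charges (a ∷ D) = adjust (charges D) (pairOf (rem6 a)) (push (side (rem6 a)))

Encodes : List ℕ → Charges → Set
Encodes D c = ∀ m → (m ∈ D → m ∈ᶜ c) × (m ∈ᶜ c → m ∈ D)

6∣[r+6*[q+1+e]]∸[1+r+6*q]+1 : ∀ r q e → 6 ∣ ((r + 6 * (q + suc e)) ∸ suc (r + 6 * q) + 1)
6∣[r+6*[q+1+e]]∸[1+r+6*q]+1 r q e =
  subst (6 ∣_) (sym (trans (cong (λ t → t ∸ suc (r + 6 * q) + 1) (regroup r q e)) (m+[1+d]∸[1+m]+1≡1+d (r + 6 * q) (5 + 6 * e))))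
    (divides (suc e) (six-multiple e))
  where
  regroup : ∀ r q e → r + 6 * (q + suc e) ≡ r + 6 * q + suc (5 + 6 * e)
  regroup = ℕ-Solver.solve-∀
  six-multiple : ∀ e → suc (5 + 6 * e) ≡ suc e * 6
  six-multiple = ℕ-Solver.solve-∀

¬Bead-zero : ∀ σ q i → ¬ Bead σ q (charge (+ 0 , + 0 , + 0) i)
¬Bead-zero true  q p05 ()
¬Bead-zero true  q p14 ()
¬Bead-zero true  q p23 ()
¬Bead-zero false q p05 ()
¬Bead-zero false q p14 ()
¬Bead-zero false q p23 ()

-- When a is added outside the arms D, the runner of a holds exactly the levels below quot6 a
-- (the gap condition of CoreArms) and its partner runner is empty (the arm condition).
charge-outer-arm : ∀ a D → All (_< a) D → CoreArms (a ∷ D) → Encodes D (charges D) →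
  charge (charges D) (pairOf (rem6 a)) ≡ fill (side (rem6 a)) (quot6 a)
charge-outer-arm a D D<a (_ , arm-hooks , gap-hooks) enc = charge≡fill σ q z below ¬at ¬opposite
  where
  s = rem6 a
  q = quot6 a
  σ = side s
  c = charges D
  z = charge c (pairOf s)
  below : ∀ q′ → q′ < q → Bead σ q′ z
  below q′ q′<q with (toℕ s + 6 * q′) ∈? D
  ... | yes m∈D = BeadAt-cong {c} (rem6-toℕ+6* s q′) (quot6-toℕ+6* s q′) (proj₁ (enc _) m∈D)
  ... | no m∉D = ⊥-elim (gap-hooks m m<a m∉D (subst (λ t → 6 ∣ (t ∸ suc m + 1)) (sym a≡) (6∣[r+6*[q+1+e]]∸[1+r+6*q]+1 (toℕ s) q′ e)))
    where
    m = toℕ s + 6 * q′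
    e = q ∸ suc q′
    a≡ : a ≡ toℕ s + 6 * (q′ + suc e)
    a≡ = trans (n≡rem6+6*quot6 a) (cong (λ t → toℕ s + 6 * t) (sym (trans (+-suc q′ e) (m+[n∸m]≡n q′<q))))
    m<a : m < a
    m<a = subst (m <_) (sym a≡) (+-monoʳ-< (toℕ s) (*-monoʳ-< 6 (m<m+n q′ (s≤s z≤n))))
  ¬at : ¬ Bead σ q z
  ¬at b = All<⇒∉ D D<a ≤-refl (proj₂ (enc a) b)
  ¬opposite : ¬ Bead (not σ) 0 z
  ¬opposite b = arm-hooks m (proj₂ (enc m) m∈c)
    (rem6≡r0⇒6∣ (a + m + 1) (trans (rem6-hook a m) (trans (cong (hook₆ s) (rem6-toℕ+6* (partner s) 0)) (hook₆-partner s))))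
    where
    m = toℕ (partner s) + 6 * 0
    m∈c : m ∈ᶜ c
    m∈c = Bead⇒toℕ-residue+6*∈ᶜ c (pairOf s) (not σ) 0 b

charges-encodes : ∀ D → AllPairs _>_ D → CoreArms D → Encodes D (charges D)
charges-encodes []      _          _ m = (λ ()) , (λ b → ⊥-elim (¬Bead-zero (side (rem6 m)) (quot6 m) (pairOf (rem6 m)) b))
charges-encodes (a ∷ D) (D<a ∷ D↓) core@(coreD , _ , _) m with pairOf (rem6 m) ≟ᵖ pairOf (rem6 a)
... | no other-pair = (λ { (here refl) → ⊥-elim (other-pair refl) ; (there m∈D) → subst (Bead τ qm) (sym unchanged) (proj₁ (enc m) m∈D) })
                    , (λ b → there (proj₂ (enc m) (subst (Bead τ qm) unchanged b)))
  where
  enc = charges-encodes D D↓ coreD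
  τ = side (rem6 m)
  qm = quot6 m
  unchanged : charge (charges (a ∷ D)) (pairOf (rem6 m)) ≡ charge (charges D) (pairOf (rem6 m))
  unchanged = charge-adjust-≢ (charges D) (pairOf (rem6 a)) (pairOf (rem6 m)) _ other-pair
... | yes same-pair = into , outof
  where
  enc = charges-encodes D D↓ coreD
  σ = side (rem6 a)
  q = quot6 a
  τ = side (rem6 m)
  qm = quot6 m
  before : charge (charges D) (pairOf (rem6 m)) ≡ fill σ q
  before = trans (cong (charge (charges D)) same-pair) (charge-outer-arm a D D<a core enc)
  after : charge (charges (a ∷ D)) (pairOf (rem6 m)) ≡ fill σ (suc q)
  after = trans (cong (charge (charges (a ∷ D))) same-pair)
            (trans (charge-adjust-≡ (charges D) (pairOf (rem6 a)) (push σ))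
              (trans (cong (push σ) (charge-outer-arm a D D<a core enc)) (push-fill σ q)))
  into : m ∈ (a ∷ D) → m ∈ᶜ charges (a ∷ D)
  into (here refl) = subst (Bead τ qm) (sym after) (<⇒Bead-fill σ (suc q) q ≤-refl)
  into (there m∈D) with τ ≟ᵇ σ
  ... | yes τ≡σ = subst (Bead τ qm) (sym after) (subst (λ t → Bead t qm (fill σ (suc q))) (sym τ≡σ)
                     (<⇒Bead-fill σ (suc q) qm (m≤n⇒m≤1+n (Bead-fill⇒< σ q qm
                       (subst (λ t → Bead t qm (fill σ q)) τ≡σ (subst (Bead τ qm) before (proj₁ (enc m) m∈D)))))))
  ... | no τ≢σ = ⊥-elim (¬Bead-fill-not σ q qm (subst (λ t → Bead t qm (fill σ q)) (¬-not τ≢σ) (subst (Bead τ qm) before (proj₁ (enc m) m∈D))))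
  outof : m ∈ᶜ charges (a ∷ D) → m ∈ (a ∷ D)
  outof b with τ ≟ᵇ σ
  ... | no τ≢σ = ⊥-elim (¬Bead-fill-not σ (suc q) qm (subst (λ t → Bead t qm (fill σ (suc q))) (¬-not τ≢σ) (subst (Bead τ qm) after b)))
  ... | yes τ≡σ with m≤n⇒m<n∨m≡n (≤-pred (Bead-fill⇒< σ (suc q) qm (subst (λ t → Bead t qm (fill σ (suc q))) τ≡σ (subst (Bead τ qm) after b))))
  ...   | inj₂ qm≡q = here (rem6-quot6-injective m a (pairOf-side-injective (rem6 m) (rem6 a) same-pair τ≡σ) qm≡q)
  ...   | inj₁ qm<q = there (proj₂ (enc m) (subst (Bead τ qm) (sym before) (subst (λ t → Bead t qm (fill σ q)) (sym τ≡σ) (<⇒Bead-fill σ q qm qm<q))))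

-- The sum of three squares

offset : Pair → ℕ
offset p05 = 5
offset p14 = 3
offset p23 = 1

coord : Pair → ℤ → ℤ
coord i z = + 12 ℤ.* z ℤ.- + offset i

toTriple : Charges → Triple
toTriple (c₀ , c₁ , c₂) = (coord p23 c₂ , coord p14 c₁ , coord p05 c₀)

sumOfSquares : Triple → ℤ
sumOfSquares (x , y , z) = x ℤ.* x ℤ.+ y ℤ.* y ℤ.+ z ℤ.* z

sq : ℤ → ℤ
sq x = x ℤ.* x

sumOfSquares-adjust : ∀ c i f δ → sq (coord i (f (charge c i))) ≡ sq (coord i (charge c i)) ℤ.+ δ →
  sumOfSquares (toTriple (adjust c i f)) ≡ sumOfSquares (toTriple c) ℤ.+ δ
sumOfSquares-adjust (x , y , z) p05 f δ step =
  trans (cong (λ t → sq (coord p23 z) ℤ.+ sq (coord p14 y) ℤ.+ t) step) (last (sq (coord p23 z)) (sq (coord p14 y)) (sq (coord p05 x)) δ)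
  where
  last : ∀ u v w d → u ℤ.+ v ℤ.+ (w ℤ.+ d) ≡ u ℤ.+ v ℤ.+ w ℤ.+ d
  last = ℤ-Solver.solve-∀
sumOfSquares-adjust (x , y , z) p14 f δ step =
  trans (cong (λ t → sq (coord p23 z) ℤ.+ t ℤ.+ sq (coord p05 x)) step) (middle (sq (coord p23 z)) (sq (coord p14 y)) (sq (coord p05 x)) δ)
  where
  middle : ∀ u v w d → u ℤ.+ (v ℤ.+ d) ℤ.+ w ≡ u ℤ.+ v ℤ.+ w ℤ.+ d
  middle = ℤ-Solver.solve-∀
sumOfSquares-adjust (x , y , z) p23 f δ step =
  trans (cong (λ t → t ℤ.+ sq (coord p14 y) ℤ.+ sq (coord p05 x)) step) (first (sq (coord p23 z)) (sq (coord p14 y)) (sq (coord p05 x)) δ)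
  where
  first : ∀ u v w d → (u ℤ.+ d) ℤ.+ v ℤ.+ w ≡ u ℤ.+ v ℤ.+ w ℤ.+ d
  first = ℤ-Solver.solve-∀

-- With 6 ∓ w = 2 toℕ s + 1, these are the two sides of sq-coord-push-fill below.
sq-12[1+q]-w : ∀ w q → (+ 12 ℤ.* (+ 1 ℤ.+ q) ℤ.- w) ℤ.* (+ 12 ℤ.* (+ 1 ℤ.+ q) ℤ.- w) ≡
  (+ 12 ℤ.* q ℤ.- w) ℤ.* (+ 12 ℤ.* q ℤ.- w) ℤ.+ (+ 24 ℤ.* (+ 6 ℤ.- w) ℤ.+ + 288 ℤ.* q)
sq-12[1+q]-w = ℤ-Solver.solve-∀

sq-12[-1-q]-w : ∀ w q → (+ 12 ℤ.* (- + 1 ℤ.+ - q) ℤ.- w) ℤ.* (+ 12 ℤ.* (- + 1 ℤ.+ - q) ℤ.- w) ≡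
  (+ 12 ℤ.* (- q) ℤ.- w) ℤ.* (+ 12 ℤ.* (- q) ℤ.- w) ℤ.+ (+ 24 ℤ.* (+ 6 ℤ.+ w) ℤ.+ + 288 ℤ.* q)
sq-12[-1-q]-w = ℤ-Solver.solve-∀

24*[2[t+6q]+1] : ∀ t q → + (24 * suc ((t + 6 * q) + (t + 6 * q))) ≡ + 24 ℤ.* + suc (t + t) ℤ.+ + 288 ℤ.* + q
24*[2[t+6q]+1] t q = begin
  + (24 * suc ((t + 6 * q) + (t + 6 * q)))   ≡⟨ cong +_ (expand t q) ⟩
  + (24 * suc (t + t) + 288 * q)             ≡⟨ ℤP.pos-+ (24 * suc (t + t)) (288 * q) ⟩
  + (24 * suc (t + t)) ℤ.+ + (288 * q)       ≡⟨ cong₂ ℤ._+_ (ℤP.pos-* 24 (suc (t + t))) (ℤP.pos-* 288 q) ⟩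
  + 24 ℤ.* + suc (t + t) ℤ.+ + 288 ℤ.* + q   ∎
  where
  open ≡.≡-Reasoning
  expand : ∀ t q → 24 * suc ((t + 6 * q) + (t + 6 * q)) ≡ 24 * suc (t + t) + 288 * q
  expand = ℕ-Solver.solve-∀

sq-coord-push-fill : ∀ s q → sq (coord (pairOf s) (push (side s) (fill (side s) q))) ≡
  sq (coord (pairOf s) (fill (side s) q)) ℤ.+ + (24 * suc ((toℕ s + 6 * q) + (toℕ s + 6 * q)))
sq-coord-push-fill s q =
  trans (by-residue s q) (cong (ℤ._+_ (sq (coord (pairOf s) (fill (side s) q)))) (sym (24*[2[t+6q]+1] (toℕ s) q)))
  where
  by-residue : ∀ s q → sq (coord (pairOf s) (push (side s) (fill (side s) q))) ≡
    sq (coord (pairOf s) (fill (side s) q)) ℤ.+ (+ 24 ℤ.* + suc (toℕ s + toℕ s) ℤ.+ + 288 ℤ.* + q)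
  by-residue r0 q = sq-12[1+q]-w (+ 5) (+ q)
  by-residue r1 q = sq-12[1+q]-w (+ 3) (+ q)
  by-residue r2 q = sq-12[1+q]-w (+ 1) (+ q)
  by-residue r3 q = sq-12[-1-q]-w (+ 1) (+ q)
  by-residue r4 q = sq-12[-1-q]-w (+ 3) (+ q)
  by-residue r5 q = sq-12[-1-q]-w (+ 5) (+ q)

sumOfSquares-push : ∀ c s q → charge c (pairOf s) ≡ fill (side s) q →
  sumOfSquares (toTriple (adjust c (pairOf s) (push (side s)))) ≡
  sumOfSquares (toTriple c) ℤ.+ + (24 * suc ((toℕ s + 6 * q) + (toℕ s + 6 * q)))
sumOfSquares-push c s q c≡ = sumOfSquares-adjust c (pairOf s) (push (side s)) _ (begin
  sq (coord i (push σ (charge c i)))   ≡⟨ cong (λ z → sq (coord i (push σ z))) c≡ ⟩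
  sq (coord i (push σ (fill σ q)))     ≡⟨ sq-coord-push-fill s q ⟩
  sq (coord i (fill σ q)) ℤ.+ _        ≡⟨ cong (λ z → sq (coord i z) ℤ.+ _) c≡ ⟨
  sq (coord i (charge c i)) ℤ.+ _      ∎)
  where
  open ≡.≡-Reasoning
  i = pairOf s
  σ = side s

sumOfSquares-charges : ∀ D → AllPairs _>_ D → CoreArms D → sumOfSquares (toTriple (charges D)) ≡ + (24 * hookSum D + 35)
sumOfSquares-charges []      _          _                  = refl
sumOfSquares-charges (a ∷ D) (D<a ∷ D↓) core@(coreD , _ , _) = begin
  sumOfSquares (toTriple (charges (a ∷ D)))                       ≡⟨ sumOfSquares-push (charges D) (rem6 a) (quot6 a) outer ⟩
  sumOfSquares (toTriple (charges D)) ℤ.+ + (24 * suc (a′ + a′))  ≡⟨ cong (λ v → sumOfSquares (toTriple (charges D)) ℤ.+ + (24 * suc (v + v))) {a} {a′} (n≡rem6+6*quot6 a) ⟨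
  sumOfSquares (toTriple (charges D)) ℤ.+ + (24 * suc (a + a))    ≡⟨ cong (ℤ._+ + (24 * suc (a + a))) (sumOfSquares-charges D D↓ coreD) ⟩
  + (24 * hookSum D + 35) ℤ.+ + (24 * suc (a + a))                 ≡⟨ ℤP.pos-+ (24 * hookSum D + 35) (24 * suc (a + a)) ⟨
  + (24 * hookSum D + 35 + 24 * suc (a + a))                       ≡⟨ cong +_ (regroup a (hookSum D)) ⟩
  + (24 * hookSum (a ∷ D) + 35)                                    ∎
  where
  open ≡.≡-Reasoning
  a′ = toℕ (rem6 a) + 6 * quot6 a
  outer = charge-outer-arm a D D<a core (charges-encodes D D↓ coreD)
  regroup : ∀ a s → 24 * s + 35 + 24 * suc (a + a) ≡ 24 * (suc (a + a) + s) + 35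
  regroup = ℕ-Solver.solve-∀

armsBelow : Charges → ℕ → List ℕ
armsBelow c zero = []
armsBelow c (suc B) with B ∈ᶜ? c
... | yes _ = B ∷ armsBelow c B
... | no _  = armsBelow c B

∈-armsBelow : ∀ c B m → (m ∈ armsBelow c B → m ∈ᶜ c × m < B) × (m ∈ᶜ c → m < B → m ∈ armsBelow c B)
∈-armsBelow c zero    m = (λ ()) , (λ _ ())
∈-armsBelow c (suc B) m with B ∈ᶜ? c
... | yes B∈c = (λ { (here refl) → B∈c , ≤-refl ; (there m∈) → Prod.map₂ m<n⇒m<1+n (proj₁ below m∈) }) , into
  where
  below = ∈-armsBelow c B m
  into : m ∈ᶜ c → m < suc B → m ∈ (B ∷ armsBelow c B)
  into m∈c m<1+B with m≤n⇒m<n∨m≡n (≤-pred m<1+B)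
  ... | inj₁ m<B  = there (proj₂ below m∈c m<B)
  ... | inj₂ refl = here refl
... | no B∉c = (λ m∈ → Prod.map₂ m<n⇒m<1+n (proj₁ below m∈)) , into
  where
  below = ∈-armsBelow c B m
  into : m ∈ᶜ c → m < suc B → m ∈ armsBelow c B
  into m∈c m<1+B with m≤n⇒m<n∨m≡n (≤-pred m<1+B)
  ... | inj₁ m<B  = proj₂ below m∈c m<B
  ... | inj₂ refl = ⊥-elim (B∉c m∈c)

armsBelow-decreasing : ∀ c B → AllPairs _>_ (armsBelow c B)
armsBelow-decreasing c zero = []
armsBelow-decreasing c (suc B) with B ∈ᶜ? c
... | yes _ = All.tabulate (λ {m} m∈ → proj₂ (proj₁ (∈-armsBelow c B m) m∈)) ∷ armsBelow-decreasing c B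
... | no _  = armsBelow-decreasing c B

-- Arms on partner runners never form a hook divisible by 6 (bead sets on the two runners of a
-- pair exclude each other), and the bead sets are initial segments, so no gap hook is either.
armsBelow-core : ∀ c B → CoreArms (armsBelow c B)
armsBelow-core c zero = tt
armsBelow-core c (suc B) with B ∈ᶜ? c
... | no _    = armsBelow-core c B
... | yes B∈c = armsBelow-core c B , arm-hooks , gap-hooks
  where
  s = rem6 B
  arm-hooks : ∀ a → a ∈ armsBelow c B → ¬ 6 ∣ (B + a + 1)
  arm-hooks a a∈ 6∣ = Bead⇒¬Bead-not (side s) (quot6 B) (quot6 a) (charge c (pairOf s)) B∈c
    (toℕ-residue+6*∈ᶜ⇒Bead c (pairOf s) (not (side s)) (quot6 a)
      (subst (_∈ᶜ c) (trans (n≡rem6+6*quot6 a) (cong (λ r → toℕ r + 6 * quot6 a) a≡partner)) (proj₁ (proj₁ (∈-armsBelow c B a) a∈))))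
    where
    a≡partner : rem6 a ≡ partner s
    a≡partner = hook₆≡r0⇒partner s (rem6 a) (trans (sym (rem6-hook B a)) (6∣⇒rem6≡r0 _ 6∣))
  gap-hooks : ∀ m → m < B → m ∉ armsBelow c B → ¬ 6 ∣ (B ∸ suc m + 1)
  gap-hooks m m<B m∉ 6∣ = m∉ (proj₂ (∈-armsBelow c B m) m∈c m<B)
    where
    same = 6∣difference⇒rem6≡ m B m<B 6∣
    m∈c : m ∈ᶜ c
    m∈c = BeadAt-cong {c} (sym same) refl (Bead-≤ (side s) (quot6 B) (quot6 m) (charge c (pairOf s)) B∈c (<⇒≤ (quot6-mono-< m B same m<B)))

Bead-injective : ∀ z z′ → (∀ σ q → Bead σ q z → Bead σ q z′) → (∀ σ q → Bead σ q z′ → Bead σ q z) → z ≡ z′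
Bead-injective (+ k)    (+ k′)    into outof = cong +_ (≤-antisym (k≤ k k′ (into true)) (k≤ k′ k (outof true)))
  where
  k≤ : ∀ k k′ → (∀ q → q < k → q < k′) → k ≤ k′
  k≤ zero    _ _     = z≤n
  k≤ (suc k) _ below = below k ≤-refl
Bead-injective (+ k)    -[1+ k′ ] into outof = ⊥-elim (outof false 0 z≤n)
Bead-injective -[1+ k ] (+ k′)    into outof = ⊥-elim (into false 0 z≤n)
Bead-injective -[1+ k ] -[1+ k′ ] into outof = cong -[1+_] (≤-antisym (into false k ≤-refl) (outof false k′ ≤-refl))

∈ᶜ-injective : ∀ c c′ → (∀ m → m ∈ᶜ c → m ∈ᶜ c′) → (∀ m → m ∈ᶜ c′ → m ∈ᶜ c) → c ≡ c′
∈ᶜ-injective c c′ into outof = cong₂ _,_ (same p05) (cong₂ _,_ (same p14) (same p23))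
  where
  same : ∀ i → charge c i ≡ charge c′ i
  same i = Bead-injective (charge c i) (charge c′ i)
    (λ σ q b → toℕ-residue+6*∈ᶜ⇒Bead c′ i σ q (into (toℕ (residue i σ) + 6 * q) (Bead⇒toℕ-residue+6*∈ᶜ c i σ q b)))
    (λ σ q b → toℕ-residue+6*∈ᶜ⇒Bead c i σ q (outof (toℕ (residue i σ) + 6 * q) (Bead⇒toℕ-residue+6*∈ᶜ c′ i σ q b)))

decreasing-ext : ∀ D D′ → AllPairs _>_ D → AllPairs _>_ D′ → (∀ m → m ∈ D → m ∈ D′) → (∀ m → m ∈ D′ → m ∈ D) → D ≡ D′
decreasing-ext []      []       _          _            _    _     = refl
decreasing-ext []      (b ∷ D′) _          _            _    outof with outof b (here refl)
... | ()
decreasing-ext (a ∷ D) []       _          _            into _     with into a (here refl)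
... | ()
decreasing-ext (a ∷ D) (b ∷ D′) (D<a ∷ D↓) (D′<b ∷ D′↓) into outof = cong₂ _∷_ a≡b (decreasing-ext D D′ D↓ D′↓ into′ outof′)
  where
  a≡b : a ≡ b
  a≡b with into a (here refl) | outof b (here refl)
  ... | here a≡b   | _          = a≡b
  ... | there _    | here b≡a   = sym b≡a
  ... | there a∈D′ | there b∈D  = ⊥-elim (<-asym (All.lookup D′<b a∈D′) (All.lookup D<a b∈D))
  into′ : ∀ m → m ∈ D → m ∈ D′
  into′ m m∈D with into m (there m∈D)
  ... | here m≡b = ⊥-elim (<-irrefl (trans m≡b (sym a≡b)) (All.lookup D<a m∈D))
  ... | there m∈D′ = m∈D′
  outof′ : ∀ m → m ∈ D′ → m ∈ D
  outof′ m m∈D′ with outof m (there m∈D′)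
  ... | here m≡a = ⊥-elim (<-irrefl (trans m≡a a≡b) (All.lookup D′<b m∈D′))
  ... | there m∈D = m∈D

-- The correspondence

chargeSize : Charges → ℕ
chargeSize (x , y , z) = ∣ x ∣ + ∣ y ∣ + ∣ z ∣

∣charge∣≤chargeSize : ∀ c i → ∣ charge c i ∣ ≤ chargeSize c
∣charge∣≤chargeSize (x , y , z) p05 = ≤-trans (m≤m+n ∣ x ∣ ∣ y ∣) (m≤m+n _ ∣ z ∣)
∣charge∣≤chargeSize (x , y , z) p14 = ≤-trans (m≤n+m ∣ y ∣ ∣ x ∣) (m≤m+n _ ∣ z ∣)
∣charge∣≤chargeSize (x , y , z) p23 = m≤n+m ∣ z ∣ _

Bead⇒<∣z∣ : ∀ σ q z → Bead σ q z → q < ∣ z ∣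
Bead⇒<∣z∣ true  q (+ k)    q<k = q<k
Bead⇒<∣z∣ false q -[1+ k ] q≤k = s≤s q≤k

∈ᶜ⇒<6*chargeSize : ∀ c m → m ∈ᶜ c → m < 6 * chargeSize c
∈ᶜ⇒<6*chargeSize c m m∈c = begin-strict
  m                              ≡⟨ n≡rem6+6*quot6 m ⟩
  toℕ (rem6 m) + 6 * quot6 m     <⟨ +-monoˡ-< (6 * quot6 m) (toℕ<6 (rem6 m)) ⟩
  6 + 6 * quot6 m                ≡⟨ *-suc 6 (quot6 m) ⟨
  6 * suc (quot6 m)              ≤⟨ *-monoʳ-≤ 6 (≤-trans (Bead⇒<∣z∣ _ _ _ m∈c) (∣charge∣≤chargeSize c (pairOf (rem6 m)))) ⟩
  6 * chargeSize c               ∎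
  where open ≤-Reasoning

charges-armsBelow : ∀ c → charges (armsBelow c (6 * chargeSize c)) ≡ c
charges-armsBelow c = ∈ᶜ-injective (charges D) c
  (λ m m∈ → proj₁ (proj₁ (∈-armsBelow c B m) (proj₂ (enc m) m∈)))
  (λ m m∈c → proj₁ (enc m) (proj₂ (∈-armsBelow c B m) m∈c (∈ᶜ⇒<6*chargeSize c m m∈c)))
  where
  B = 6 * chargeSize c
  D = armsBelow c B
  enc = charges-encodes D (armsBelow-decreasing c B) (armsBelow-core c B)

charges-injective : ∀ D D′ → AllPairs _>_ D → CoreArms D → AllPairs _>_ D′ → CoreArms D′ → charges D ≡ charges D′ → D ≡ D′
charges-injective D D′ D↓ coreD D′↓ coreD′ c≡ = decreasing-ext D D′ D↓ D′↓
  (λ m m∈D → proj₂ (enc′ m) (subst (m ∈ᶜ_) c≡ (proj₁ (enc m) m∈D)))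
  (λ m m∈D′ → proj₂ (enc m) (subst (m ∈ᶜ_) (sym c≡) (proj₁ (enc′ m) m∈D′)))
  where
  enc = charges-encodes D D↓ coreD
  enc′ = charges-encodes D′ D′↓ coreD′

ℤ∣⇒quotient : ∀ m w → (+ m) ℤD.∣ w → Σ ℤ λ k → w ≡ k ℤ.* + m
ℤ∣⇒quotient m w (divides q ∣w∣≡q*m) with ℤP.+∣i∣≡i⊎+∣i∣≡-i w
... | inj₁ +∣w∣≡w  = + q , trans (sym +∣w∣≡w) (trans (cong +_ ∣w∣≡q*m) (ℤP.pos-* q m))
... | inj₂ +∣w∣≡-w = - + q , (begin
  w                ≡⟨ ℤP.neg-involutive w ⟨
  - - w            ≡⟨ cong -_ +∣w∣≡-w ⟨
  - + ∣ w ∣        ≡⟨ cong (λ t → - + t) ∣w∣≡q*m ⟩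
  - + (q * m)      ≡⟨ cong -_ (ℤP.pos-* q m) ⟩
  - (+ q ℤ.* + m)  ≡⟨ ℤP.neg-distribˡ-* (+ q) (+ m) ⟩
  - + q ℤ.* + m    ∎)
  where open ≡.≡-Reasoning

coord-≡±[mod] : ∀ i z → ≡±[mod] (coord i z) (offset i) 12
coord-≡±[mod] i z = inj₂ (divides ∣ z ∣ (trans (cong ∣_∣ (12z-w+w z (+ offset i))) (ℤP.abs-* z (+ 12))))
  where
  12z-w+w : ∀ z w → (+ 12 ℤ.* z ℤ.- w) ℤ.- (- w) ≡ z ℤ.* + 12
  12z-w+w = ℤ-Solver.solve-∀

≡±[mod]⇒coord : ∀ x i → ≡±[mod] x (offset i) 12 → Σ ℤ λ z → SignEq (coord i z) x
≡±[mod]⇒coord x i (inj₂ 12∣x+w) with ℤ∣⇒quotient 12 (x ℤ.- - + offset i) 12∣x+w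
... | k , x+w≡12k = k , inj₁ (begin
  + 12 ℤ.* k ℤ.- w          ≡⟨ swap k w ⟩
  k ℤ.* + 12 ℤ.- w          ≡⟨ cong (ℤ._- w) x+w≡12k ⟨
  x ℤ.- (- w) ℤ.- w         ≡⟨ cancel x w ⟩
  x                         ∎)
  where
  open ≡.≡-Reasoning
  w = + offset i
  swap : ∀ k w → + 12 ℤ.* k ℤ.- w ≡ k ℤ.* + 12 ℤ.- w
  swap = ℤ-Solver.solve-∀
  cancel : ∀ x w → x ℤ.- (- w) ℤ.- w ≡ x
  cancel = ℤ-Solver.solve-∀
≡±[mod]⇒coord x i (inj₁ 12∣x-w) with ℤ∣⇒quotient 12 (x ℤ.- + offset i) 12∣x-w
... | k , x-w≡12k = - k , inj₂ (begin
  + 12 ℤ.* (- k) ℤ.- w      ≡⟨ swap k w ⟩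
  - (k ℤ.* + 12) ℤ.- w      ≡⟨ cong (λ t → - t ℤ.- w) x-w≡12k ⟨
  - (x ℤ.- w) ℤ.- w         ≡⟨ cancel x w ⟩
  - x                       ∎)
  where
  open ≡.≡-Reasoning
  w = + offset i
  swap : ∀ k w → + 12 ℤ.* (- k) ℤ.- w ≡ - (k ℤ.* + 12) ℤ.- w
  swap = ℤ-Solver.solve-∀
  cancel : ∀ x w → - (x ℤ.- w) ℤ.- w ≡ - x
  cancel = ℤ-Solver.solve-∀

chargesFor : ∀ x y z → ≡±[mod] x 1 12 → ≡±[mod] y 3 12 → ≡±[mod] z 5 12 → Σ Charges λ c → toTriple c ≈± (x , y , z)
chargesFor x y z x≡ y≡ z≡ =
  (proj₁ cz , proj₁ cy , proj₁ cx) , (proj₂ cx , proj₂ cy , proj₂ cz)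
  where
  cx = ≡±[mod]⇒coord x p23 x≡
  cy = ≡±[mod]⇒coord y p14 y≡
  cz = ≡±[mod]⇒coord z p05 z≡

12*t≢m : ∀ t m → 0 < m → m < 12 → 12 * t ≢ m
12*t≢m zero    (suc m) _ _    ()
12*t≢m (suc t) m       _ m<12 12*t≡m = <-irrefl refl (≤-trans m<12 (≤-trans (*-monoʳ-≤ 12 (s≤s z≤n)) (≤-reflexive 12*t≡m)))

-- Opposite signs are excluded since 12 (a + b) = 2w with 0 < 2w < 12.
coord-SignEq-injective : ∀ i a b → SignEq (coord i a) (coord i b) → a ≡ b
coord-SignEq-injective i a b (inj₁ same) = ℤP.*-cancelˡ-≡ (+ 12) a b (begin
  + 12 ℤ.* a                  ≡⟨ add-back (+ 12 ℤ.* a) w ⟩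
  coord i a ℤ.+ w             ≡⟨ cong (ℤ._+ w) same ⟩
  coord i b ℤ.+ w             ≡⟨ add-back (+ 12 ℤ.* b) w ⟨
  + 12 ℤ.* b                  ∎)
  where
  open ≡.≡-Reasoning
  w = + offset i
  add-back : ∀ u v → u ≡ (u ℤ.- v) ℤ.+ v
  add-back = ℤ-Solver.solve-∀
coord-SignEq-injective i a b (inj₂ opposite) = ⊥-elim
  (12*t≢m ∣ a ℤ.+ b ∣ (offset i + offset i) (0<2w i) (2w<12 i) (trans (sym (ℤP.abs-* (+ 12) (a ℤ.+ b))) (cong ∣_∣ 12[a+b]≡2w)))
  where
  w = + offset i
  regroup : ∀ a b w → + 12 ℤ.* (a ℤ.+ b) ≡ ((+ 12 ℤ.* a ℤ.- w) ℤ.- (- (+ 12 ℤ.* b ℤ.- w))) ℤ.+ (w ℤ.+ w)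
  regroup = ℤ-Solver.solve-∀
  cancel : ∀ u v → (u ℤ.- u) ℤ.+ v ≡ v
  cancel = ℤ-Solver.solve-∀
  12[a+b]≡2w : + 12 ℤ.* (a ℤ.+ b) ≡ + (offset i + offset i)
  12[a+b]≡2w = trans (regroup a b w) (trans (cong (λ t → (t ℤ.- (- coord i b)) ℤ.+ (w ℤ.+ w)) opposite) (cancel (- coord i b) (w ℤ.+ w)))
  0<2w : ∀ i → 0 < offset i + offset i
  0<2w p05 = s≤s z≤n
  0<2w p14 = s≤s z≤n
  0<2w p23 = s≤s z≤n
  2w<12 : ∀ i → offset i + offset i < 12
  2w<12 p05 = toWitness {a? = 10 <? 12} tt
  2w<12 p14 = toWitness {a? = 6 <? 12} tt
  2w<12 p23 = toWitness {a? = 2 <? 12} tt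

toTriple-injective : ∀ c c′ → toTriple c ≈± toTriple c′ → c ≡ c′
toTriple-injective (a₀ , a₁ , a₂) (b₀ , b₁ , b₂) (e₂ , e₁ , e₀) =
  cong₂ _,_ (coord-SignEq-injective p05 a₀ b₀ e₀) (cong₂ _,_ (coord-SignEq-injective p14 a₁ b₁ e₁) (coord-SignEq-injective p23 a₂ b₂ e₂))

SignEq⇒sq≡ : ∀ u v → SignEq u v → sq u ≡ sq v
SignEq⇒sq≡ u .u       (inj₁ refl) = refl
SignEq⇒sq≡ .(- v) v   (inj₂ refl) = neg-sq v
  where
  neg-sq : ∀ v → (- v) ℤ.* (- v) ≡ v ℤ.* v
  neg-sq = ℤ-Solver.solve-∀

sumOfSquares-≈± : ∀ t t′ → t ≈± t′ → sumOfSquares t ≡ sumOfSquares t′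
sumOfSquares-≈± (x , y , z) (x′ , y′ , z′) (ex , ey , ez) =
  cong₂ ℤ._+_ (cong₂ ℤ._+_ (SignEq⇒sq≡ x x′ ex) (SignEq⇒sq≡ y y′ ey)) (SignEq⇒sq≡ z z′ ez)

armsOf : List ℕ → List ℕ
armsOf l = toArms (length l) l

record Arms (n : ℕ) (l : List ℕ) : Set where
  field
    decreasing    : AllPairs _>_ (armsOf l)
    core          : CoreArms (armsOf l)
    fromArms-arms : fromArms (armsOf l) ≡ l
    hookSum≡      : hookSum (armsOf l) ≡ n

armsOf-facts : ∀ n l → SC6 n l → Arms n l
armsOf-facts n l ((L , pos , sum≡n) , self , core) = record
  { decreasing    = D↓
  ; core          = Core₀⇒CoreArms D D↓ (subst Core₀ (sym l≡) (IsCore⇒Core₀ l sym-l core))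
  ; fromArms-arms = l≡
  ; hookSum≡      = trans (sym (FromArms.sum≡hookSum (fromArms-facts D D↓))) (trans (cong sum l≡) sum≡n)
  }
  where
  sym-l = SelfConjugate⇒Symmetric l L self
  D = armsOf l
  rebuilt = fromArms-toArms (length l) l L pos sym-l ≤-refl
  D↓ = proj₁ rebuilt
  l≡ = proj₂ rebuilt

fromArms-SC6 : ∀ n D → AllPairs _>_ D → CoreArms D → hookSum D ≡ n → SC6 n (fromArms D)
fromArms-SC6 n D D↓ core hookSum≡n =
  ( (FromArms.decreasing F , FromArms.positive F , trans (FromArms.sum≡hookSum F) hookSum≡n)
  , Symmetric⇒SelfConjugate (fromArms D) (FromArms.positive F) (FromArms.symmetric F)
  , Core₀⇒IsCore (fromArms D) (FromArms.symmetric F) (CoreArms⇒Core₀ D D↓ core))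
  where F = fromArms-facts D D↓

armsOf-fromArms : ∀ D → AllPairs _>_ D → armsOf (fromArms D) ≡ D
armsOf-fromArms D D↓ = toArms-fromArms (length (fromArms D)) D D↓
  (≤-trans (length≤width D D↓) (≤-reflexive (sym (FromArms.length≡width (fromArms-facts D D↓)))))

tripleOf : List ℕ → Triple
tripleOf l = toTriple (charges (armsOf l))

tripleOf-InS6 : ∀ n l → SC6 n l → InS6 n (tripleOf l)
tripleOf-InS6 n l sc6 =
  trans (sumOfSquares-charges (armsOf l) (Arms.decreasing A) (Arms.core A)) (cong (λ t → + (24 * t + 35)) (Arms.hookSum≡ A))
  , coord-≡±[mod] p23 (charge c p23) , coord-≡±[mod] p14 (charge c p14) , coord-≡±[mod] p05 (charge c p05)
  where
  A = armsOf-facts n l sc6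
  c = charges (armsOf l)

tripleOf-injective : ∀ n l l′ → SC6 n l → SC6 n l′ → tripleOf l ≈± tripleOf l′ → l ≡ l′
tripleOf-injective n l l′ sc6 sc6′ t≈ = begin
  l                      ≡⟨ Arms.fromArms-arms A ⟨
  fromArms (armsOf l)    ≡⟨ cong fromArms (charges-injective _ _ (Arms.decreasing A) (Arms.core A) (Arms.decreasing A′) (Arms.core A′)
                              (toTriple-injective _ _ t≈)) ⟩
  fromArms (armsOf l′)   ≡⟨ Arms.fromArms-arms A′ ⟩
  l′                     ∎
  where
  open ≡.≡-Reasoning
  A = armsOf-facts n l sc6
  A′ = armsOf-facts n l′ sc6′

partitionOf : Charges → List ℕ
partitionOf c = fromArms (armsBelow c (6 * chargeSize c))

tripleOf-partitionOf : ∀ c → tripleOf (partitionOf c) ≡ toTriple c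
tripleOf-partitionOf c = cong toTriple (trans (cong charges (armsOf-fromArms D (armsBelow-decreasing c B))) (charges-armsBelow c))
  where
  B = 6 * chargeSize c
  D = armsBelow c B

partitionOf-SC6 : ∀ n c → sumOfSquares (toTriple c) ≡ + (24 * n + 35) → SC6 n (partitionOf c)
partitionOf-SC6 n c norm≡ = fromArms-SC6 n D D↓ core
  (*-cancelˡ-≡ (hookSum D) n 24 (+-cancelʳ-≡ 35 (24 * hookSum D) (24 * n) (ℤP.+-injective (begin
    + (24 * hookSum D + 35)              ≡⟨ sumOfSquares-charges D D↓ core ⟨
    sumOfSquares (toTriple (charges D))  ≡⟨ cong (sumOfSquares ∘ toTriple) (charges-armsBelow c) ⟩
    sumOfSquares (toTriple c)            ≡⟨ norm≡ ⟩
    + (24 * n + 35)                      ∎))))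
  where
  open ≡.≡-Reasoning
  B = 6 * chargeSize c
  D = armsBelow c B
  D↓ = armsBelow-decreasing c B
  core = armsBelow-core c B

toS6 : ∀ n → Σ (List ℕ) (SC6 n) → Σ Triple (InS6 n)
toS6 n (l , sc6) = tripleOf l , tripleOf-InS6 n l sc6

theorem3p4 : (n : ℕ) → Bijection (SC6Setoid n) (S6Setoid n)
theorem3p4 n = record
  { to        = toS6 n
  ; cong      = λ l≡l′ → ≈±.reflexive (cong tripleOf l≡l′)
  ; bijective = (λ {(l , sc6)} {(l′ , sc6′)} → tripleOf-injective n l l′ sc6 sc6′) , surjective
  }
  where
  module ≈± = IsEquivalence ≈±-isEquivalence
  surjective : ∀ (t : Σ Triple (InS6 n)) → Σ (Σ (List ℕ) (SC6 n)) λ p →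
    ∀ {p′ : Σ (List ℕ) (SC6 n)} → proj₁ p′ ≡ proj₁ p → tripleOf (proj₁ p′) ≈± proj₁ t
  surjective ((x , y , z) , norm≡ , x≡ , y≡ , z≡) =
    (partitionOf c , partitionOf-SC6 n c (trans (sumOfSquares-≈± _ _ c≈) norm≡)) ,
    λ l≡ → ≈±.trans (≈±.reflexive (trans (cong tripleOf l≡) (tripleOf-partitionOf c))) c≈
    where
    c = proj₁ (chargesFor x y z x≡ y≡ z≡)
    c≈ = proj₂ (chargesFor x y z x≡ y≡ z≡)
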